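{- Let $\lambda$ be a nonzero real number. Define the degenerate A-algorithm matrix $(b_{n,m}(\lambda))_{n,m\ge0}$ by $b_{0,m}(\lambda)=(1/2)^m$ for $m\ge0$ and \[ b_{n,m}(\lambda)=(m+1)\Big(\Big(1-\frac{(n-1)\lambda}{m+1}\Big)b_{n-1,m}(\lambda)-b_{n-1,m+1}(\lambda)\Big),\qquad n\ge1,\ m\ge0. \] Then for every $n\ge0$, \[ b_{n,0}(\lambda)=\sum_{k=0}^{n}(-1)^{k}k!\Big({n+1 \brace k+1}_{\lambda}+n\lambda {n \brace k+1}_{\lambda}\Big)\Big(\frac12\Big)^{k}=\mathcal{E}_{n,\lambda}(1), \] and for every $n\ge1$, \[ \sum_{k=0}^{n}S_{1,\lambda}(n,k)\,\mathcal{E}_{k,\lambda}(1)=(-1)^{n-1}\frac{n!}{2^{n}}. \]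
   Context: For $n\ge0$ set $(x)_{0,\lambda}=1$, $(x)_{n,\lambda}=x(x-\lambda)\cdots(x-(n-1)\lambda)$ for $n\ge1$, and $(x)_0=1$, $(x)_n=x(x-1)\cdots(x-n+1)$ for $n\ge1$. The degenerate exponential is $e_\lambda^x(t)=\sum_{k\ge0}(x)_{k,\lambda}\frac{t^k}{k!}$ (i.e. $(1+\lambda t)^{x/\lambda}$), $e_\lambda(t)=e_\lambda^1(t)$, and $\log_\lambda$ is the compositional inverse of $e_\lambda$, so $\log_\lambda(1+t)=\sum_{n\ge1}\frac{(-1)^{n-1}}{n}\binom{n-1-\lambda}{n-1}t^n$. The degenerate Stirling numbers of the second kind ${n \brace k}_{\lambda}$ are defined by $(x)_{n,\lambda}=\sum_{k=0}^{n}{n \brace k}_{\lambda}(x)_{k}$ (zero for $k>n$); the degenerate Stirling numbers of the first kind $S_{1,\lambda}(n,k)$ are defined by $\frac{1}{k!}(\log_\lambda(1+t))^k=\sum_{n\ge k}S_{1,\lambda}(n,k)\frac{t^n}{n!}$. The degenerate Euler polynomials are defined by $\frac{2}{e_\lambda(t)+1}e_\lambda^x(t)=\sum_{n\ge0}\mathcal{E}_{n,\lambda}(x)\frac{t^n}{n!}$. -}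

module Defs where

open import Level using (_⊔_) renaming (suc to lsuc)
open import Data.Nat using (ℕ; zero; suc; _∸_)
open import Data.Nat.Combinatorics using (_C_)
open import Algebra.Bundles using (CommutativeRing)

ringFromℕ : ∀ {c ℓ} (R : CommutativeRing c ℓ) → ℕ → CommutativeRing.Carrier R
ringFromℕ R zero = CommutativeRing.0# R
ringFromℕ R (suc n) = CommutativeRing._+_ R (CommutativeRing.1# R) (ringFromℕ R n)

-- A commutative ring R in which every positive integer 1,2,3,... is invertible
-- (i.e. a ℚ-algebra); inv n is the inverse of (n+1).  ℝ is an instance.
record QAlgebra c ℓ : Set (lsuc (c ⊔ ℓ)) where
  field
    cring : CommutativeRing c ℓ
    inv   : ℕ → CommutativeRing.Carrier cring
    inv-r : ∀ n → CommutativeRing._≈_ cring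
                    (CommutativeRing._*_ cring (ringFromℕ cring (suc n)) (inv n))
                    (CommutativeRing.1# cring)
  open CommutativeRing cring public
  fromℕ : ℕ → Carrier
  fromℕ = ringFromℕ cring

module Ops {c ℓ} (A : QAlgebra c ℓ) where
  open QAlgebra A

  pow : Carrier → ℕ → Carrier
  pow x zero = 1#
  pow x (suc n) = x * pow x n

  sgn : ℕ → Carrier
  sgn n = pow (- 1#) n

  half : Carrier
  half = inv 1

  invFact : ℕ → Carrier
  invFact zero = 1#
  invFact (suc n) = inv n * invFact n

  fact : ℕ → Carrier
  fact zero = 1#
  fact (suc n) = fromℕ (suc n) * fact n

  sumTo : ℕ → (ℕ → Carrier) → Carrier
  sumTo zero f = f 0
  sumTo (suc n) f = sumTo n f + f (suc n)

  fall : Carrier → ℕ → Carrier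
  fall x zero = 1#
  fall x (suc n) = fall x n * (x - fromℕ n)

  fallλ : Carrier → Carrier → ℕ → Carrier
  fallλ lam x zero = 1#
  fallλ lam x (suc n) = fallλ lam x n * (x - fromℕ n * lam)

  -- formal power series in t, as (ordinary) coefficient sequences
  PS : Set c
  PS = ℕ → Carrier

  _·_ : PS → PS → PS
  (a · b) n = sumTo n (λ j → a j * b (n ∸ j))

  onePS : PS
  onePS zero = 1#
  onePS (suc n) = 0#

  _⊕_ : PS → PS → PS
  (a ⊕ b) n = a n + b n

  _⊛_ : Carrier → PS → PS
  (r ⊛ a) n = r * a n

  powPS : PS → ℕ → PS
  powPS a zero = onePS
  powPS a (suc k) = a · powPS a k

  eλx : Carrier → Carrier → PS
  eλx lam x n = fallλ lam x n * invFact n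

  eλ : Carrier → PS
  eλ lam = eλx lam 1#

  binom : Carrier → ℕ → Carrier
  binom y j = fall y j * invFact j

  logλ : Carrier → PS
  logλ lam zero = 0#
  logλ lam (suc m) = sgn m * inv m * binom (fromℕ m - lam) m

  -- degenerate Stirling numbers of the first kind:
  -- (1/k!) (log_λ(1+t))^k = Σ_n S_{1,λ}(n,k) t^n/n!,
  -- i.e. S_{1,λ}(n,k) = n! * [t^n] (log_λ(1+t))^k / k!
  S1λ : Carrier → ℕ → ℕ → Carrier
  S1λ lam n k = fact n * (invFact k * powPS (logλ lam) k n)

  bmat : Carrier → ℕ → ℕ → Carrier
  bmat lam zero m = pow half m
  bmat lam (suc n) m =
    fromℕ (suc m) * ((1# - fromℕ n * lam * inv m) * bmat lam n m - bmat lam n (suc m))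

  IsS2λ : Carrier → (ℕ → ℕ → Carrier) → Set (c ⊔ ℓ)
  IsS2λ lam S2 =
    (∀ n x → fallλ lam x n ≈ sumTo n (λ k → S2 n k * fall x k))
    × (∀ n k → n Data.Nat.< k → S2 n k ≈ 0#)
    where open import Data.Product using (_×_)
          import Data.Nat

  -- E is the family of degenerate Euler polynomials:
  -- (e_λ(t) + 1) * Σ_n E_n(x) t^n/n! = 2 e_λ^x(t)  (i.e. 2/(e_λ(t)+1) e_λ^x(t) = Σ E_n(x) t^n/n!)
  IsEulerλ : Carrier → (ℕ → Carrier → Carrier) → Set (c ⊔ ℓ)
  IsEulerλ lam E = ∀ x n →
    ((eλ lam ⊕ onePS) · (λ k → E k x * invFact k)) n ≈ ((1# + 1#) ⊛ eλx lam x) n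

{-# OPTIONS --safe #-}
-- Everything is read off from formal power series over the ℚ-algebra, with θ = t·d/dt.
-- Put e = e_λ(t) and u = Σ E_n(1) tⁿ/n! = 2e/(e + 1).  From (1 + λt)e′ = e one gets the
-- Riccati equation (1 + λt)u′ = u − u²/2, so the powers u^(m+1) obey exactly the recurrence
-- of the A-algorithm: b_{n,m} = n! 2⁻ᵐ [tⁿ] u^(m+1), and in particular b_{n,0} = E_n(1).
-- Expanding 2/(e + 1) = Σₖ (−1/2)ᵏ (e − 1)ᵏ and using that S_{2,λ}(n,k) = (n!/k!) [tⁿ](e − 1)ᵏ
-- (falling-factorial coefficients are unique) gives the Stirling sum for E_n(1).  Finally the
-- matrices [tⁿ](e − 1)ʲ and [tⁿ] log_λ(1 + t)ᵏ are inverse to each other, since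
-- e_λ(log_λ(1 + t)) = 1 + t, so Σₖ S_{1,λ}(n,k) E_k(1) collapses to n!((−1/2)ⁿ + (−1/2)ⁿ⁻¹).
module Submission where

open import Defs
open import Data.Nat using (ℕ; zero; suc; _∸_; _≤_; _<_; z≤n; s≤s)
import Data.Nat as ℕ
import Data.Nat.Properties as ℕP
open import Data.Integer as ℤ using (ℤ; +_; -[1+_])
import Data.Integer.Properties as ℤP
open import Data.Maybe using (Maybe; just; nothing)
open import Data.Product using (_×_; _,_; proj₁; proj₂)
open import Data.Sum using (inj₁; inj₂)
open import Relation.Binary.PropositionalEquality as ≡ using (_≡_; _≢_)
open import Relation.Nullary using (¬_; Dec; yes; no; contradiction)
open import Relation.Binary.Definitions using (tri<; tri≈; tri>)
open import Data.Nat.Induction using (<-rec)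
open import Algebra.Bundles using (CommutativeRing)
open import Algebra.Solver.Ring.AlmostCommutativeRing using (fromCommutativeRing; _-Raw-AlmostCommutative⟶_)
import Algebra.Solver.Ring

-- Integer coefficients let the ring solver normalise subtraction in any commutative ring.
module IntegerCoefficientSolver {a b} (R : CommutativeRing a b) where
  open CommutativeRing R
  open import Algebra.Properties.Ring ring using (-0#≈0#; -‿involutive; -‿+-comm; -‿distribˡ-*)
  open import Algebra.Properties.Semiring.Mult.TCOptimised semiring using (1+×; ×-homo-+) renaming (_×_ to _×ᴿ_)
  open import Relation.Binary.Reasoning.Setoid setoid

  ⟦_⟧ℤ : ℤ → Carrier
  ⟦ + n ⟧ℤ = n ×ᴿ 1#
  ⟦ -[1+ n ] ⟧ℤ = - (suc n ×ᴿ 1#)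

  ⟦-⟧ℤ : ∀ i → ⟦ ℤ.- i ⟧ℤ ≈ - ⟦ i ⟧ℤ
  ⟦-⟧ℤ (+ zero) = sym -0#≈0#
  ⟦-⟧ℤ (+ suc n) = refl
  ⟦-⟧ℤ -[1+ n ] = sym (-‿involutive _)

  ⟦⊖⟧ℤ : ∀ m n → ⟦ m ℤ.⊖ n ⟧ℤ ≈ m ×ᴿ 1# - n ×ᴿ 1#
  ⟦⊖⟧ℤ m zero = sym (trans (+-congˡ -0#≈0#) (+-identityʳ _))
  ⟦⊖⟧ℤ zero (suc n) = sym (+-identityˡ _)
  ⟦⊖⟧ℤ (suc m) (suc n) = begin
    ⟦ suc m ℤ.⊖ suc n ⟧ℤ          ≡⟨ ≡.cong ⟦_⟧ℤ (ℤP.[1+m]⊖[1+n]≡m⊖n m n) ⟩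
    ⟦ m ℤ.⊖ n ⟧ℤ                  ≈⟨ ⟦⊖⟧ℤ m n ⟩
    x - y                         ≈⟨ +-congʳ (+-identityˡ x) ⟨
    (0# + x) - y                  ≈⟨ +-congʳ (+-congʳ (-‿inverseʳ 1#)) ⟨
    ((1# - 1#) + x) - y           ≈⟨ +-assoc _ _ _ ⟩
    (1# - 1#) + (x - y)           ≈⟨ +-assoc _ _ _ ⟩
    1# + (- 1# + (x - y))         ≈⟨ +-congˡ (+-assoc _ _ _) ⟨
    1# + ((- 1# + x) - y)         ≈⟨ +-congˡ (+-congʳ (+-comm _ _)) ⟩
    1# + ((x - 1#) - y)           ≈⟨ +-congˡ (+-assoc _ _ _) ⟩
    1# + (x + (- 1# - y))         ≈⟨ +-assoc _ _ _ ⟨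
    (1# + x) + (- 1# - y)         ≈⟨ +-congˡ (-‿+-comm 1# y) ⟩
    (1# + x) - (1# + y)           ≈⟨ +-cong (1+× m 1#) (-‿cong (1+× n 1#)) ⟨
    suc m ×ᴿ 1# - suc n ×ᴿ 1#     ∎
    where x = m ×ᴿ 1#; y = n ×ᴿ 1#

  ⟦+⟧ℤ : ∀ i j → ⟦ i ℤ.+ j ⟧ℤ ≈ ⟦ i ⟧ℤ + ⟦ j ⟧ℤ
  ⟦+⟧ℤ -[1+ m ] -[1+ n ] = begin
    - (suc (suc (m ℕ.+ n)) ×ᴿ 1#)   ≡⟨ ≡.cong (λ k → - (suc k ×ᴿ 1#)) (ℕP.+-suc m n) ⟨
    - ((suc m ℕ.+ suc n) ×ᴿ 1#)     ≈⟨ -‿cong (×-homo-+ 1# (suc m) (suc n)) ⟩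
    - (suc m ×ᴿ 1# + suc n ×ᴿ 1#)    ≈⟨ -‿+-comm _ _ ⟨
    - (suc m ×ᴿ 1#) - (suc n ×ᴿ 1#)  ∎
  ⟦+⟧ℤ -[1+ m ] (+ n) = trans (⟦⊖⟧ℤ n (suc m)) (+-comm _ _)
  ⟦+⟧ℤ (+ m) -[1+ n ] = ⟦⊖⟧ℤ m (suc n)
  ⟦+⟧ℤ (+ m) (+ n) = ×-homo-+ 1# m n

  ⟦+*⟧ℤ : ∀ m j → ⟦ + m ℤ.* j ⟧ℤ ≈ (m ×ᴿ 1#) * ⟦ j ⟧ℤ
  ⟦+*⟧ℤ zero j = sym (zeroˡ _)
  ⟦+*⟧ℤ (suc m) j = begin
    ⟦ + suc m ℤ.* j ⟧ℤ                  ≡⟨ ≡.cong ⟦_⟧ℤ (ℤP.suc-* (+ m) j) ⟩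
    ⟦ j ℤ.+ + m ℤ.* j ⟧ℤ                ≈⟨ ⟦+⟧ℤ j (+ m ℤ.* j) ⟩
    ⟦ j ⟧ℤ + ⟦ + m ℤ.* j ⟧ℤ             ≈⟨ +-cong (sym (*-identityˡ _)) (⟦+*⟧ℤ m j) ⟩
    1# * ⟦ j ⟧ℤ + (m ×ᴿ 1#) * ⟦ j ⟧ℤ     ≈⟨ distribʳ _ _ _ ⟨
    (1# + m ×ᴿ 1#) * ⟦ j ⟧ℤ              ≈⟨ *-congʳ (1+× m 1#) ⟨
    (suc m ×ᴿ 1#) * ⟦ j ⟧ℤ               ∎

  ⟦*⟧ℤ : ∀ i j → ⟦ i ℤ.* j ⟧ℤ ≈ ⟦ i ⟧ℤ * ⟦ j ⟧ℤ
  ⟦*⟧ℤ (+ m) j = ⟦+*⟧ℤ m j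
  ⟦*⟧ℤ -[1+ m ] j = begin
    ⟦ -[1+ m ] ℤ.* j ⟧ℤ                 ≡⟨ ≡.cong ⟦_⟧ℤ (ℤP.neg-distribˡ-* (+ suc m) j) ⟨
    ⟦ ℤ.- (+ suc m ℤ.* j) ⟧ℤ            ≈⟨ ⟦-⟧ℤ (+ suc m ℤ.* j) ⟩
    - ⟦ + suc m ℤ.* j ⟧ℤ                ≈⟨ -‿cong (⟦+*⟧ℤ (suc m) j) ⟩
    - (⟦ + suc m ⟧ℤ * ⟦ j ⟧ℤ)           ≈⟨ -‿distribˡ-* _ _ ⟩
    - ⟦ + suc m ⟧ℤ * ⟦ j ⟧ℤ             ∎

  ℤ⟶R : ℤ.+-*-rawRing -Raw-AlmostCommutative⟶ fromCommutativeRing R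
  ℤ⟶R = record
    { ⟦_⟧ = ⟦_⟧ℤ ; +-homo = ⟦+⟧ℤ ; *-homo = ⟦*⟧ℤ ; -‿homo = ⟦-⟧ℤ
    ; 0-homo = refl ; 1-homo = refl }

  ⟦≟⟧ℤ : ∀ i j → Maybe (⟦ i ⟧ℤ ≈ ⟦ j ⟧ℤ)
  ⟦≟⟧ℤ i j with i ℤ.≟ j
  ... | yes ≡.refl = just refl
  ... | no _ = nothing

  open Algebra.Solver.Ring ℤ.+-*-rawRing (fromCommutativeRing R) ℤ⟶R ⟦≟⟧ℤ public
    using (solve; _:+_; _:*_; _:-_; :-_; con; _:=_)

module Arithmetic {c ℓ} (A : QAlgebra c ℓ) where
  open QAlgebra A hiding (zero)
  open Ops A
  open IntegerCoefficientSolver cring using (solve; _:+_; _:*_; _:-_; _:=_)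
  open import Algebra.Properties.Ring ring public
    using (-0#≈0#; -‿distribˡ-*; -‿distribʳ-*)
    renaming (x≈y⇒x∙y⁻¹≈ε to x≈y⇒x-y≈0; x∙y⁻¹≈ε⇒x≈y to x-y≈0⇒x≈y)
  open import Relation.Binary.Reasoning.Setoid setoid

  inv-inverseˡ : ∀ n → inv n * fromℕ (suc n) ≈ 1#
  inv-inverseˡ n = trans (*-comm _ _) (inv-r n)

  fact-invFact : ∀ n → fact n * invFact n ≈ 1#
  fact-invFact zero = *-identityˡ 1#
  fact-invFact (suc n) = begin
    (fromℕ (suc n) * fact n) * (inv n * invFact n)
      ≈⟨ solve 4 (λ a b x y → (a :* b) :* (x :* y) := (a :* x) :* (b :* y)) refl (fromℕ (suc n)) (fact n) (inv n) (invFact n) ⟩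
    (fromℕ (suc n) * inv n) * (fact n * invFact n) ≈⟨ *-cong (inv-r n) (fact-invFact n) ⟩
    1# * 1#                                       ≈⟨ *-identityˡ 1# ⟩
    1#                                            ∎

  two : Carrier
  two = 1# + 1#

  half-two : half * two ≈ 1#
  half-two = trans (*-comm _ _) (trans (*-congʳ (+-congˡ (sym (+-identityʳ 1#)))) (inv-r 1))

  u*x≈0⇒x≈0 : ∀ {w u x} → w * u ≈ 1# → u * x ≈ 0# → x ≈ 0#
  u*x≈0⇒x≈0 {w} {u} {x} wu≈1 ux≈0 = begin
    x             ≈⟨ *-identityˡ x ⟨
    1# * x        ≈⟨ *-congʳ wu≈1 ⟨
    (w * u) * x   ≈⟨ *-assoc w u x ⟩
    w * (u * x)   ≈⟨ *-congˡ ux≈0 ⟩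
    w * 0#        ≈⟨ zeroʳ w ⟩
    0#            ∎

  fromℕ-suc-*-cancelˡ : ∀ n {x y} → fromℕ (suc n) * x ≈ fromℕ (suc n) * y → x ≈ y
  fromℕ-suc-*-cancelˡ n {x} {y} nx≈ny = x-y≈0⇒x≈y x y (u*x≈0⇒x≈0 (inv-inverseˡ n) (begin
    fromℕ (suc n) * (x - y)                   ≈⟨ solve 3 (λ a x y → a :* (x :- y) := a :* x :- a :* y) refl (fromℕ (suc n)) x y ⟩
    fromℕ (suc n) * x - fromℕ (suc n) * y     ≈⟨ x≈y⇒x-y≈0 nx≈ny ⟩
    0#                                        ∎))

  sumTo-cong≤ : ∀ n {f g : ℕ → Carrier} → (∀ k → k ≤ n → f k ≈ g k) → sumTo n f ≈ sumTo n g
  sumTo-cong≤ zero f≈g = f≈g 0 z≤n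
  sumTo-cong≤ (suc n) f≈g = +-cong (sumTo-cong≤ n (λ k k≤n → f≈g k (ℕP.m≤n⇒m≤1+n k≤n))) (f≈g (suc n) ℕP.≤-refl)

  sumTo-cong : ∀ n {f g : ℕ → Carrier} → (∀ k → f k ≈ g k) → sumTo n f ≈ sumTo n g
  sumTo-cong n f≈g = sumTo-cong≤ n (λ k _ → f≈g k)

  sumTo-+ : ∀ n (f g : ℕ → Carrier) → sumTo n (λ k → f k + g k) ≈ sumTo n f + sumTo n g
  sumTo-+ zero f g = refl
  sumTo-+ (suc n) f g = trans (+-congʳ (sumTo-+ n f g))
    (solve 4 (λ a b x y → (a :+ b) :+ (x :+ y) := (a :+ x) :+ (b :+ y)) refl _ _ _ _)

  *-distribˡ-sumTo : ∀ n r (f : ℕ → Carrier) → r * sumTo n f ≈ sumTo n (λ k → r * f k)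
  *-distribˡ-sumTo zero r f = refl
  *-distribˡ-sumTo (suc n) r f = trans (distribˡ r _ _) (+-congʳ (*-distribˡ-sumTo n r f))

  sumTo-linear : ∀ n a b (f g : ℕ → Carrier) → sumTo n (λ k → a * f k + b * g k) ≈ a * sumTo n f + b * sumTo n g
  sumTo-linear n a b f g =
    trans (sumTo-+ n _ _) (sym (+-cong (*-distribˡ-sumTo n a f) (*-distribˡ-sumTo n b g)))

  sumTo-zero : ∀ n (f : ℕ → Carrier) → (∀ k → k ≤ n → f k ≈ 0#) → sumTo n f ≈ 0#
  sumTo-zero n f f≈0 = trans (sumTo-cong≤ n f≈0) (sumTo-0# n)
    where
    sumTo-0# : ∀ n → sumTo n (λ _ → 0#) ≈ 0#
    sumTo-0# zero = refl
    sumTo-0# (suc n) = trans (+-identityʳ _) (sumTo-0# n)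

  sumTo-unfoldˡ : ∀ n (f : ℕ → Carrier) → sumTo (suc n) f ≈ f 0 + sumTo n (λ k → f (suc k))
  sumTo-unfoldˡ zero f = refl
  sumTo-unfoldˡ (suc n) f = trans (+-congʳ (sumTo-unfoldˡ n f)) (+-assoc _ _ _)

  sumTo-single : ∀ n j (f : ℕ → Carrier) → j ≤ n → (∀ k → k ≤ n → k ≢ j → f k ≈ 0#) → sumTo n f ≈ f j
  sumTo-single zero .zero f z≤n others≈0 = refl
  sumTo-single (suc n) j f j≤1+n others≈0 with ℕP.m≤n⇒m<n∨m≡n j≤1+n
  ... | inj₂ ≡.refl = trans (+-congʳ (sumTo-zero n f (λ k k≤n → others≈0 k (ℕP.m≤n⇒m≤1+n k≤n) (ℕP.<⇒≢ (s≤s k≤n))))) (+-identityˡ _)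
  ... | inj₁ (s≤s j≤n) = trans (+-cong (sumTo-single n j f j≤n (λ k k≤n → others≈0 k (ℕP.m≤n⇒m≤1+n k≤n)))
                                       (others≈0 (suc n) ℕP.≤-refl (ℕP.>⇒≢ (s≤s j≤n))))
                               (+-identityʳ _)

  sumTo-truncate : ∀ m n (f : ℕ → Carrier) → n ≤ m → (∀ k → n < k → k ≤ m → f k ≈ 0#) → sumTo m f ≈ sumTo n f
  sumTo-truncate zero .zero f z≤n tail≈0 = refl
  sumTo-truncate (suc m) n f n≤1+m tail≈0 with ℕP.m≤n⇒m<n∨m≡n n≤1+m
  ... | inj₂ ≡.refl = refl
  ... | inj₁ (s≤s n≤m) = trans (+-cong (sumTo-truncate m n f n≤m (λ k n<k k≤m → tail≈0 k n<k (ℕP.m≤n⇒m≤1+n k≤m)))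
                                       (tail≈0 (suc m) (s≤s n≤m) ℕP.≤-refl))
                               (+-identityʳ _)

  sumTo-shift : ∀ n (f : ℕ → Carrier) → f 0 ≈ 0# → f (suc n) ≈ 0# → sumTo n f ≈ sumTo n (λ k → f (suc k))
  sumTo-shift n f f₀≈0 f₁₊ₙ≈0 = begin
    sumTo n f                           ≈⟨ +-identityʳ _ ⟨
    sumTo n f + 0#                      ≈⟨ +-congˡ f₁₊ₙ≈0 ⟨
    sumTo (suc n) f                     ≈⟨ sumTo-unfoldˡ n f ⟩
    f 0 + sumTo n (λ k → f (suc k))     ≈⟨ +-congʳ f₀≈0 ⟩
    0# + sumTo n (λ k → f (suc k))      ≈⟨ +-identityˡ _ ⟩
    sumTo n (λ k → f (suc k))           ∎

  sumTo-swap : ∀ n m (F : ℕ → ℕ → Carrier) → sumTo n (λ i → sumTo m (F i)) ≈ sumTo m (λ j → sumTo n (λ i → F i j))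
  sumTo-swap zero m F = refl
  sumTo-swap (suc n) m F = trans (+-congʳ (sumTo-swap n m F)) (sym (sumTo-+ m _ _))

  sumTo-reverse : ∀ n (f : ℕ → Carrier) → sumTo n f ≈ sumTo n (λ j → f (n ∸ j))
  sumTo-reverse zero f = refl
  sumTo-reverse (suc n) f = begin
    sumTo n f + f (suc n)                    ≈⟨ +-comm _ _ ⟩
    f (suc n) + sumTo n f                    ≈⟨ +-congˡ (sumTo-reverse n f) ⟩
    f (suc n) + sumTo n (λ j → f (n ∸ j))    ≈⟨ sumTo-unfoldˡ n (λ j → f (suc n ∸ j)) ⟨
    sumTo (suc n) (λ j → f (suc n ∸ j))      ∎

module FormalSeries {c ℓ} (A : QAlgebra c ℓ) where
  open QAlgebra A hiding (zero)
  open Ops A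
  open Arithmetic A
  open IntegerCoefficientSolver cring using (solve; _:+_; _:*_; _:-_; _:=_)
  open import Relation.Binary.Reasoning.Setoid setoid

  infix 4 _≋_
  _≋_ : PS → PS → Set ℓ
  a ≋ b = ∀ n → a n ≈ b n

  infixr 2 _⨾_
  _⨾_ : ∀ {a b d} → a ≋ b → b ≋ d → a ≋ d
  (a≋b ⨾ b≋d) n = trans (a≋b n) (b≋d n)

  zeroPS : PS
  zeroPS _ = 0#

  negPS : PS → PS
  negPS a n = - a n

  tail : PS → PS
  tail a n = a (suc n)

  ·-unfold : ∀ a b n → (a · b) (suc n) ≈ a 0 * b (suc n) + (tail a · b) n
  ·-unfold a b n = sumTo-unfoldˡ n (λ j → a j * b (suc n ∸ j))

  ·-cong : ∀ {a a′ b b′} → a ≋ a′ → b ≋ b′ → (a · b) ≋ (a′ · b′)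
  ·-cong a≋a′ b≋b′ n = sumTo-cong n (λ k → *-cong (a≋a′ k) (b≋b′ (n ∸ k)))

  ·-congˡ : ∀ a {b b′} → b ≋ b′ → (a · b) ≋ (a · b′)
  ·-congˡ a = ·-cong (λ n → refl {a n})

  ·-congʳ : ∀ b {a a′} → a ≋ a′ → (a · b) ≋ (a′ · b)
  ·-congʳ b a≋a′ = ·-cong a≋a′ (λ n → refl {b n})

  ·-comm : ∀ a b → (a · b) ≋ (b · a)
  ·-comm a b n = begin
    sumTo n (λ j → a j * b (n ∸ j))                  ≈⟨ sumTo-reverse n _ ⟩
    sumTo n (λ j → a (n ∸ j) * b (n ∸ (n ∸ j)))      ≈⟨ sumTo-cong≤ n (λ k k≤n →
                                                          trans (*-comm _ _) (*-congʳ (reflexive (≡.cong b (ℕP.m∸[m∸n]≡n k≤n))))) ⟩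
    sumTo n (λ j → b j * a (n ∸ j))                  ∎

  ·-distribʳ : ∀ a b d → ((a ⊕ b) · d) ≋ ((a · d) ⊕ (b · d))
  ·-distribʳ a b d n = trans (sumTo-cong n (λ k → distribʳ _ _ _)) (sumTo-+ n _ _)

  ⊛-· : ∀ r a b → ((r ⊛ a) · b) ≋ (r ⊛ (a · b))
  ⊛-· r a b n = trans (sumTo-cong n (λ k → *-assoc _ _ _)) (sym (*-distribˡ-sumTo n r _))

  one-· : ∀ a → (onePS · a) ≋ a
  one-· a zero = *-identityˡ _
  one-· a (suc n) = trans (·-unfold onePS a n)
    (trans (+-cong (*-identityˡ _) (sumTo-zero n _ (λ k _ → zeroˡ _))) (+-identityʳ _))

  ·-assoc : ∀ a b d → ((a · b) · d) ≋ (a · (b · d))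
  ·-assoc a b d zero = *-assoc _ _ _
  ·-assoc a b d (suc n) = begin
    ((a · b) · d) (suc n)
      ≈⟨ ·-unfold (a · b) d n ⟩
    (a 0 * b 0) * d (suc n) + (tail (a · b) · d) n
      ≈⟨ +-congˡ (·-cong {b = d} (·-unfold a b) (λ _ → refl) n) ⟩
    (a 0 * b 0) * d (suc n) + (((a 0 ⊛ tail b) ⊕ (tail a · b)) · d) n
      ≈⟨ +-congˡ (·-distribʳ _ _ d n) ⟩
    (a 0 * b 0) * d (suc n) + (((a 0 ⊛ tail b) · d) n + ((tail a · b) · d) n)
      ≈⟨ +-congˡ (+-cong (⊛-· (a 0) (tail b) d n) (·-assoc (tail a) b d n)) ⟩
    (a 0 * b 0) * d (suc n) + (a 0 * (tail b · d) n + (tail a · (b · d)) n)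
      ≈⟨ solve 5 (λ x y z u v → (x :* y) :* z :+ (x :* u :+ v) := x :* (y :* z :+ u) :+ v) refl _ _ _ _ _ ⟩
    a 0 * (b 0 * d (suc n) + (tail b · d) n) + (tail a · (b · d)) n
      ≈⟨ +-congʳ (*-congˡ (·-unfold b d n)) ⟨
    a 0 * (b · d) (suc n) + (tail a · (b · d)) n
      ≈⟨ ·-unfold a (b · d) n ⟨
    (a · (b · d)) (suc n) ∎

  seriesRing : CommutativeRing c ℓ
  seriesRing = record
    { Carrier = PS
    ; _≈_ = _≋_
    ; _+_ = _⊕_
    ; _*_ = _·_
    ; -_ = negPS
    ; 0# = zeroPS
    ; 1# = onePS
    ; isCommutativeRing = record
      { isRing = record
        { +-isAbelianGroup = record
          { isGroup = record
            { isMonoid = record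
              { isSemigroup = record
                { isMagma = record
                  { isEquivalence = record
                    { refl = λ n → refl
                    ; sym = λ p n → sym (p n)
                    ; trans = λ p q n → trans (p n) (q n) }
                  ; ∙-cong = λ p q n → +-cong (p n) (q n) }
                ; assoc = λ _ _ _ n → +-assoc _ _ _ }
              ; identity = (λ _ n → +-identityˡ _) , (λ _ n → +-identityʳ _) }
            ; inverse = (λ _ n → -‿inverseˡ _) , (λ _ n → -‿inverseʳ _)
            ; ⁻¹-cong = λ p n → -‿cong (p n) }
          ; comm = λ _ _ n → +-comm _ _ }
        ; *-cong = ·-cong
        ; *-assoc = ·-assoc
        ; *-identity = one-· , (λ a n → trans (·-comm a onePS n) (one-· a n))
        ; distrib = (λ a b d n → trans (·-comm a (b ⊕ d) n)
                                   (trans (·-distribʳ b d a n) (+-cong (·-comm b a n) (·-comm d a n))))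
                  , (λ a b d → ·-distribʳ b d a) }
      ; *-comm = ·-comm }
    }

  module S = CommutativeRing seriesRing
  open IntegerCoefficientSolver seriesRing public using ()
    renaming (solve to solveS; _:+_ to _⊞_; _:*_ to _⊠_; _:-_ to _⊟_; :-_ to ⊟_; con to κ; _:=_ to _≐_)
  open import Algebra.Properties.Ring S.ring public using ()
    renaming (x≈y⇒x∙y⁻¹≈ε to a≋b⇒a-b≋0; x∙y⁻¹≈ε⇒x≈y to a-b≋0⇒a≋b)

  ·-annihilateʳ : ∀ a {b} → b ≋ zeroPS → (a · b) ≋ zeroPS
  ·-annihilateʳ a b≋0 = ·-congˡ a b≋0 ⨾ S.zeroʳ a

  ⊕-zero : ∀ {a b} → a ≋ zeroPS → b ≋ zeroPS → (a ⊕ b) ≋ zeroPS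
  ⊕-zero a≋0 b≋0 = S.+-cong a≋0 b≋0 ⨾ S.+-identityʳ zeroPS

  ·-distribʳ-sumTo : ∀ N (F : ℕ → PS) b → ((λ j → sumTo N (λ k → F k j)) · b) ≋ (λ j → sumTo N (λ k → (F k · b) j))
  ·-distribʳ-sumTo zero F b = S.refl
  ·-distribʳ-sumTo (suc N) F b m =
    trans (·-distribʳ (λ j → sumTo N (λ k → F k j)) (F (suc N)) b m) (+-congʳ (·-distribʳ-sumTo N F b m))

  t : PS
  t zero = 0#
  t (suc n) = onePS n

  t-·-zero : ∀ a → (t · a) 0 ≈ 0#
  t-·-zero a = zeroˡ _

  t-·-suc : ∀ a n → (t · a) (suc n) ≈ a n
  t-·-suc a n = trans (·-unfold t a n) (trans (+-congʳ (zeroˡ _)) (trans (+-identityˡ _) (one-· a n)))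

  cst : Carrier → PS
  cst r = r ⊛ onePS

  cst-· : ∀ r a n → (cst r · a) n ≈ r * a n
  cst-· r a n = trans (⊛-· r onePS a n) (*-congˡ (one-· a n))

  cst-t-·-zero : ∀ r a → ((cst r · t) · a) 0 ≈ 0#
  cst-t-·-zero r a = trans (·-assoc (cst r) t a 0) (trans (cst-· r (t · a) 0) (trans (*-congˡ (t-·-zero a)) (zeroʳ r)))

  cst-t-·-suc : ∀ r a n → ((cst r · t) · a) (suc n) ≈ r * a n
  cst-t-·-suc r a n = trans (·-assoc (cst r) t a (suc n)) (trans (cst-· r (t · a) (suc n)) (*-congˡ (t-·-suc a n)))

  cst-fromℕ-suc : ∀ k → cst (fromℕ (suc k)) ≋ (onePS ⊕ cst (fromℕ k))
  cst-fromℕ-suc k n = trans (distribʳ _ _ _) (+-congʳ (*-identityˡ _))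

  fromℕ-+ : ∀ m n → fromℕ (m ℕ.+ n) ≈ fromℕ m + fromℕ n
  fromℕ-+ zero n = sym (+-identityˡ _)
  fromℕ-+ (suc m) n = trans (+-congˡ (fromℕ-+ m n)) (sym (+-assoc _ _ _))

  θ : PS → PS
  θ a n = fromℕ n * a n

  θ-cong : ∀ {a b} → a ≋ b → θ a ≋ θ b
  θ-cong a≋b n = *-congˡ (a≋b n)

  θ-⊕ : ∀ a b → θ (a ⊕ b) ≋ (θ a ⊕ θ b)
  θ-⊕ a b n = distribˡ _ _ _

  θ-neg : ∀ a → θ (negPS a) ≋ negPS (θ a)
  θ-neg a n = sym (-‿distribʳ-* _ _)

  θ-one : θ onePS ≋ zeroPS
  θ-one zero = zeroˡ _
  θ-one (suc n) = zeroʳ _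

  θ-· : ∀ a b → θ (a · b) ≋ ((θ a · b) ⊕ (a · θ b))
  θ-· a b n = begin
    fromℕ n * sumTo n (λ j → a j * b (n ∸ j))                    ≈⟨ *-distribˡ-sumTo n _ _ ⟩
    sumTo n (λ j → fromℕ n * (a j * b (n ∸ j)))                  ≈⟨ sumTo-cong≤ n leibniz ⟩
    sumTo n (λ j → θ a j * b (n ∸ j) + a j * θ b (n ∸ j))        ≈⟨ sumTo-+ n _ _ ⟩
    (θ a · b) n + (a · θ b) n                                    ∎
    where
    leibniz : ∀ j → j ≤ n → fromℕ n * (a j * b (n ∸ j)) ≈ θ a j * b (n ∸ j) + a j * θ b (n ∸ j)
    leibniz j j≤n = begin
      fromℕ n * (a j * b (n ∸ j))
        ≡⟨ ≡.cong (λ m → fromℕ m * (a j * b (n ∸ j))) (ℕP.m+[n∸m]≡n j≤n) ⟨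
      fromℕ (j ℕ.+ (n ∸ j)) * (a j * b (n ∸ j))
        ≈⟨ *-congʳ (fromℕ-+ j (n ∸ j)) ⟩
      (fromℕ j + fromℕ (n ∸ j)) * (a j * b (n ∸ j))
        ≈⟨ solve 4 (λ J K x y → (J :+ K) :* (x :* y) := (J :* x) :* y :+ x :* (K :* y)) refl _ _ _ _ ⟩
      θ a j * b (n ∸ j) + a j * θ b (n ∸ j) ∎

  θ-powPS : ∀ a k → θ (powPS a (suc k)) ≋ (cst (fromℕ (suc k)) · (powPS a k · θ a))
  θ-powPS a zero =
    θ-· a onePS
    ⨾ S.+-congˡ (·-congˡ a θ-one)
    ⨾ solveS 2 (λ x y → (x ⊠ κ (+ 1)) ⊞ (y ⊠ κ (+ 0)) ≐ (κ (+ 1) ⊞ κ (+ 0)) ⊠ (κ (+ 1) ⊠ x)) S.refl (θ a) a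
    ⨾ ·-congʳ (onePS · θ a) (S.sym (cst-fromℕ-suc 0 ⨾ S.+-congˡ (λ n → zeroˡ _)))
  θ-powPS a (suc k) =
    θ-· a (powPS a (suc k))
    ⨾ S.+-congˡ (·-congˡ a (θ-powPS a k))
    ⨾ solveS 4 (λ D P x K → (D ⊠ (x ⊠ P)) ⊞ (x ⊠ (K ⊠ (P ⊠ D))) ≐ (κ (+ 1) ⊞ K) ⊠ ((x ⊠ P) ⊠ D))
        S.refl (θ a) (powPS a k) a (cst (fromℕ (suc k)))
    ⨾ ·-congʳ ((a · powPS a k) · θ a) (S.sym (cst-fromℕ-suc (suc k)))

  θ-powPS-ode : ∀ m a y k → (θ a ⊕ (m · θ a)) ≋ (t · y) →
                (θ (powPS a (suc k)) ⊕ (m · θ (powPS a (suc k))))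
                  ≋ (t · (cst (fromℕ (suc k)) · (powPS a k · y)))
  θ-powPS-ode m a y k ode =
    S.+-cong (θ-powPS a k) (·-congˡ m (θ-powPS a k))
    ⨾ solveS 4 (λ K Q D m → (K ⊠ (Q ⊠ D)) ⊞ (m ⊠ (K ⊠ (Q ⊠ D))) ≐ (K ⊠ Q) ⊠ (D ⊞ (m ⊠ D))) S.refl K Q (θ a) m
    ⨾ ·-congˡ (K · Q) ode
    ⨾ solveS 4 (λ K Q t y → (K ⊠ Q) ⊠ (t ⊠ y) ≐ t ⊠ (K ⊠ (Q ⊠ y))) S.refl K Q t y
    where
    K = cst (fromℕ (suc k))
    Q = powPS a k

  ode-coefficients : ∀ r a y → (θ a ⊕ ((cst r · t) · θ a)) ≋ (t · y) →
                     ∀ n → fromℕ (suc n) * a (suc n) ≈ y n - r * θ a n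
  ode-coefficients r a y ode n = begin
    θ a (suc n)                                         ≈⟨ solve 2 (λ x y → x := (x :+ y) :- y) refl _ _ ⟩
    (θ a (suc n) + r * θ a n) - r * θ a n               ≈⟨ +-congʳ (+-congˡ (cst-t-·-suc r (θ a) n)) ⟨
    (θ a (suc n) + ((cst r · t) · θ a) (suc n)) - r * θ a n ≈⟨ +-congʳ (ode (suc n)) ⟩
    (t · y) (suc n) - r * θ a n                         ≈⟨ +-congʳ (t-·-suc y n) ⟩
    y n - r * θ a n                                     ∎

  ·-vanishˡ : ∀ n a b → (∀ j → j ≤ n → a j ≈ 0#) → (a · b) n ≈ 0#
  ·-vanishˡ n a b a≈0 = sumTo-zero n _ (λ k k≤n → trans (*-congʳ (a≈0 k k≤n)) (zeroˡ _))

  ·-vanishʳ : ∀ n a b → (∀ j → j ≤ n → b j ≈ 0#) → (a · b) n ≈ 0#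
  ·-vanishʳ n a b b≈0 = sumTo-zero n _ (λ k k≤n → trans (*-congˡ (b≈0 (n ∸ k) (ℕP.m∸n≤m n k))) (zeroʳ _))

  powPS-vanish : ∀ a → a 0 ≈ 0# → ∀ k n → n < k → powPS a k n ≈ 0#
  powPS-vanish a a₀≈0 (suc k) zero _ = trans (*-congʳ a₀≈0) (zeroˡ _)
  powPS-vanish a a₀≈0 (suc k) (suc n) (s≤s n<k) = begin
    (a · powPS a k) (suc n)                              ≈⟨ ·-unfold a (powPS a k) n ⟩
    a 0 * powPS a k (suc n) + (tail a · powPS a k) n     ≈⟨ +-cong (trans (*-congʳ a₀≈0) (zeroˡ _))
                                                              (·-vanishʳ n (tail a) (powPS a k)
                                                                (λ j j≤n → powPS-vanish a a₀≈0 k j (ℕP.≤-<-trans j≤n n<k))) ⟩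
    0# + 0#                                              ≈⟨ +-identityˡ 0# ⟩
    0#                                                   ∎

  powPS-head : ∀ a → a 0 ≈ 1# → ∀ k → powPS a k 0 ≈ 1#
  powPS-head a a₀≈1 zero = refl
  powPS-head a a₀≈1 (suc k) = trans (*-cong a₀≈1 (powPS-head a a₀≈1 k)) (*-identityˡ 1#)

  unit-·-vanish≤ : ∀ u W N {w} → w * u 0 ≈ 1# →
                   (∀ j → j ≤ N → (u · W) j ≈ 0#) → ∀ j → j ≤ N → W j ≈ 0#
  unit-·-vanish≤ u W zero wu₀≈1 uW≈0 .zero z≤n = u*x≈0⇒x≈0 wu₀≈1 (uW≈0 0 z≤n)
  unit-·-vanish≤ u W (suc N) wu₀≈1 uW≈0 =
    extend (unit-·-vanish≤ u W N wu₀≈1 (λ i i≤N → uW≈0 i (ℕP.m≤n⇒m≤1+n i≤N)))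
    where
    extend : (∀ j → j ≤ N → W j ≈ 0#) → ∀ j → j ≤ suc N → W j ≈ 0#
    extend W≤N≈0 j j≤1+N with ℕP.m≤n⇒m<n∨m≡n j≤1+N
    ... | inj₁ (s≤s j≤N) = W≤N≈0 j j≤N
    ... | inj₂ ≡.refl = u*x≈0⇒x≈0 wu₀≈1 (begin
      u 0 * W (suc N)                        ≈⟨ +-identityʳ _ ⟨
      u 0 * W (suc N) + 0#                   ≈⟨ +-congˡ (·-vanishʳ N (tail u) W W≤N≈0) ⟨
      u 0 * W (suc N) + (tail u · W) N       ≈⟨ ·-unfold u W N ⟨
      (u · W) (suc N)                        ≈⟨ uW≈0 (suc N) ℕP.≤-refl ⟩
      0#                                     ∎)

  unit-·-vanish : ∀ u W {w} → w * u 0 ≈ 1# → (u · W) ≋ zeroPS → W ≋ zeroPS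
  unit-·-vanish u W wu₀≈1 uW≋0 n = unit-·-vanish≤ u W n wu₀≈1 (λ j _ → uW≋0 j) n ℕP.≤-refl

module FallingFactorials {c ℓ} (A : QAlgebra c ℓ) where
  open QAlgebra A hiding (zero)
  open Ops A
  open Arithmetic A
  open IntegerCoefficientSolver cring using (solve; _:+_; _:*_; _:-_; con; _:=_)
  open import Relation.Binary.Reasoning.Setoid setoid

  fall-cong : ∀ {x y} → x ≈ y → ∀ m → fall x m ≈ fall y m
  fall-cong x≈y zero = refl
  fall-cong x≈y (suc m) = *-cong (fall-cong x≈y m) (+-congʳ x≈y)

  fall-unfoldˡ : ∀ y m → fall y (suc m) ≈ y * fall (y - 1#) m
  fall-unfoldˡ y zero = solve 1 (λ y → con (+ 1) :* (y :- con (+ 0)) := y :* con (+ 1)) refl y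
  fall-unfoldˡ y (suc m) = begin
    fall y (suc m) * (y - (1# + fromℕ m))            ≈⟨ *-congʳ (fall-unfoldˡ y m) ⟩
    (y * fall (y - 1#) m) * (y - (1# + fromℕ m))
      ≈⟨ solve 3 (λ y f M → (y :* f) :* (y :- (con (+ 1) :+ M)) := y :* (f :* ((y :- con (+ 1)) :- M)))
           refl y (fall (y - 1#) m) (fromℕ m) ⟩
    y * (fall (y - 1#) m * ((y - 1#) - fromℕ m))     ∎

  fall-fromℕ-vanish : ∀ j k → j < k → fall (fromℕ j) k ≈ 0#
  fall-fromℕ-vanish j (suc k) (s≤s j≤k) with ℕP.m≤n⇒m<n∨m≡n j≤k
  ... | inj₁ j<k = trans (*-congʳ (fall-fromℕ-vanish j k j<k)) (zeroˡ _)
  ... | inj₂ ≡.refl = trans (*-congˡ (-‿inverseʳ _)) (zeroʳ _)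

  fall-fromℕ-diagonal : ∀ j → fall (fromℕ j) j ≈ fact j
  fall-fromℕ-diagonal zero = refl
  fall-fromℕ-diagonal (suc j) = begin
    fall (fromℕ (suc j)) (suc j)                 ≈⟨ fall-unfoldˡ _ j ⟩
    fromℕ (suc j) * fall ((1# + fromℕ j) - 1#) j
      ≈⟨ *-congˡ (fall-cong (solve 1 (λ x → (con (+ 1) :+ x) :- con (+ 1) := x) refl (fromℕ j)) j) ⟩
    fromℕ (suc j) * fall (fromℕ j) j             ≈⟨ *-congˡ (fall-fromℕ-diagonal j) ⟩
    fromℕ (suc j) * fact j                       ∎

  -- Evaluating at x = 0, 1, …, n gives a triangular system with diagonal entries j!.
  fall-coefficients-zero : ∀ n (d : ℕ → Carrier) → (∀ x → sumTo n (λ k → d k * fall x k) ≈ 0#) →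
                           ∀ j → j ≤ n → d j ≈ 0#
  fall-coefficients-zero n d Σ≈0 = <-rec (λ j → j ≤ n → d j ≈ 0#) step
    where
    step : ∀ j → (∀ {i} → i < j → i ≤ n → d i ≈ 0#) → j ≤ n → d j ≈ 0#
    step j below j≤n = u*x≈0⇒x≈0 (trans (*-comm _ _) (fact-invFact j)) (begin
      fact j * d j                               ≈⟨ *-comm _ _ ⟩
      d j * fact j                               ≈⟨ *-congˡ (fall-fromℕ-diagonal j) ⟨
      d j * fall (fromℕ j) j                     ≈⟨ sumTo-single n j _ j≤n others ⟨
      sumTo n (λ k → d k * fall (fromℕ j) k)     ≈⟨ Σ≈0 (fromℕ j) ⟩
      0#                                         ∎)
      where
      others : ∀ k → k ≤ n → k ≢ j → d k * fall (fromℕ j) k ≈ 0#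
      others k k≤n k≢j with ℕP.<-cmp k j
      ... | tri< k<j _ _ = trans (*-congʳ (below k<j k≤n)) (zeroˡ _)
      ... | tri≈ _ k≡j _ = contradiction k≡j k≢j
      ... | tri> _ _ j<k = trans (*-congˡ (fall-fromℕ-vanish j k j<k)) (zeroʳ _)

  fall-coefficients-unique : ∀ n (a b : ℕ → Carrier) →
                             (∀ x → sumTo n (λ k → a k * fall x k) ≈ sumTo n (λ k → b k * fall x k)) →
                             ∀ k → k ≤ n → a k ≈ b k
  fall-coefficients-unique n a b Σa≈Σb k k≤n =
    x-y≈0⇒x≈y _ _ (fall-coefficients-zero n (λ k → a k - b k) Σ[a-b]≈0 k k≤n)
    where
    Σ[a-b]≈0 : ∀ x → sumTo n (λ k → (a k - b k) * fall x k) ≈ 0#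
    Σ[a-b]≈0 x = begin
      sumTo n (λ k → (a k - b k) * fall x k)
        ≈⟨ sumTo-cong n (λ k → solve 3 (λ a b f → (a :- b) :* f := a :* f :+ con (ℤ.- (+ 1)) :* (b :* f)) refl (a k) (b k) (fall x k)) ⟩
      sumTo n (λ k → a k * fall x k + (- 1#) * (b k * fall x k))
        ≈⟨ sumTo-+ n _ _ ⟩
      sumTo n (λ k → a k * fall x k) + sumTo n (λ k → (- 1#) * (b k * fall x k))
        ≈⟨ +-congˡ (*-distribˡ-sumTo n (- 1#) _) ⟨
      sumTo n (λ k → a k * fall x k) + (- 1#) * sumTo n (λ k → b k * fall x k)
        ≈⟨ +-congˡ (*-congˡ (Σa≈Σb x)) ⟨
      sumTo n (λ k → a k * fall x k) + (- 1#) * sumTo n (λ k → a k * fall x k)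
        ≈⟨ solve 1 (λ s → s :+ con (ℤ.- (+ 1)) :* s := con (+ 0)) refl _ ⟩
      0#                                         ∎

module DegenerateSeries {c ℓ} (A : QAlgebra c ℓ) (lam : QAlgebra.Carrier A) where
  open QAlgebra A hiding (zero)
  open Ops A
  open Arithmetic A
  open FormalSeries A
  open FallingFactorials A
  open IntegerCoefficientSolver cring using (solve; _:+_; _:*_; _:-_; :-_; con; _:=_)
  open import Relation.Binary.Reasoning.Setoid setoid

  e : PS
  e = eλ lam

  λt : PS
  λt = cst lam · t

  e-head : e 0 ≈ 1#
  e-head = *-identityˡ 1#

  e-ode : (θ e ⊕ (λt · θ e)) ≋ (t · e)
  e-ode zero = trans (+-cong (zeroˡ _) (cst-t-·-zero lam (θ e))) (trans (+-identityˡ 0#) (sym (t-·-zero e)))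
  e-ode (suc m) = begin
    (1# + N) * ((x * (1# - N * lam)) * (w * y)) + (λt · θ e) (suc m)
      ≈⟨ +-congˡ (cst-t-·-suc lam (θ e) m) ⟩
    (1# + N) * ((x * (1# - N * lam)) * (w * y)) + lam * (N * (x * y))
      ≈⟨ solve 5 (λ N x y w L → (con (+ 1) :+ N) :* ((x :* (con (+ 1) :- N :* L)) :* (w :* y)) :+ L :* (N :* (x :* y))
                                := ((con (+ 1) :+ N) :* w) :* ((x :* (con (+ 1) :- N :* L)) :* y) :+ L :* (N :* (x :* y)))
               refl N x y w lam ⟩
    ((1# + N) * w) * ((x * (1# - N * lam)) * y) + lam * (N * (x * y))
      ≈⟨ +-congʳ (*-congʳ (inv-r m)) ⟩
    1# * ((x * (1# - N * lam)) * y) + lam * (N * (x * y))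
      ≈⟨ solve 4 (λ N x y L → con (+ 1) :* ((x :* (con (+ 1) :- N :* L)) :* y) :+ L :* (N :* (x :* y)) := x :* y) refl N x y lam ⟩
    x * y
      ≈⟨ t-·-suc e m ⟨
    (t · e) (suc m) ∎
    where
    N = fromℕ m
    x = fallλ lam 1# m
    y = invFact m
    w = inv m

  expm1 : PS
  expm1 = e ⊕ negPS onePS

  expm1-ode : (θ expm1 ⊕ (λt · θ expm1)) ≋ (t · e)
  expm1-ode = S.+-cong θexpm1≋θe (·-congˡ λt θexpm1≋θe) ⨾ e-ode
    where
    θexpm1≋θe : θ expm1 ≋ θ e
    θexpm1≋θe = θ-⊕ e (negPS onePS) ⨾ S.+-congˡ (θ-neg onePS ⨾ S.-‿cong θ-one) ⨾ λ n → trans (+-congˡ -0#≈0#) (+-identityʳ _)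

  expm1Pow : ℕ → ℕ → Carrier
  expm1Pow k n = powPS expm1 k n

  expm1Pow-vanish : ∀ k n → n < k → expm1Pow k n ≈ 0#
  expm1Pow-vanish = powPS-vanish expm1 (trans (+-congʳ e-head) (-‿inverseʳ 1#))

  powPS-expm1-·-e : ∀ k → (powPS expm1 k · e) ≋ (powPS expm1 k ⊕ powPS expm1 (suc k))
  powPS-expm1-·-e k = solveS 2 (λ Q e → Q ⊠ e ≐ Q ⊞ ((e ⊟ κ (+ 1)) ⊠ Q)) S.refl (powPS expm1 k) e

  expm1Pow-rec : ∀ k n → fromℕ (suc n) * expm1Pow (suc k) (suc n)
                         ≈ fromℕ (suc k) * (expm1Pow k n + expm1Pow (suc k) n) - lam * (fromℕ n * expm1Pow (suc k) n)
  expm1Pow-rec k n = begin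
    fromℕ (suc n) * expm1Pow (suc k) (suc n)
      ≈⟨ ode-coefficients lam (powPS expm1 (suc k)) (cst (fromℕ (suc k)) · (powPS expm1 k · e)) (θ-powPS-ode λt expm1 e k expm1-ode) n ⟩
    (cst (fromℕ (suc k)) · (powPS expm1 k · e)) n - lam * (fromℕ n * expm1Pow (suc k) n)
      ≈⟨ +-congʳ (trans (cst-· (fromℕ (suc k)) (powPS expm1 k · e) n) (*-congˡ (powPS-expm1-·-e k n))) ⟩
    fromℕ (suc k) * (expm1Pow k n + expm1Pow (suc k) n) - lam * (fromℕ n * expm1Pow (suc k) n) ∎

  stirling2 : ℕ → ℕ → Carrier
  stirling2 n k = fact n * (invFact k * expm1Pow k n)

  stirling2-vanish : ∀ n k → n < k → stirling2 n k ≈ 0#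
  stirling2-vanish n k n<k = trans (*-congˡ (trans (*-congˡ (expm1Pow-vanish k n n<k)) (zeroʳ _))) (zeroʳ _)

  stirling2-rec : ∀ n k → stirling2 (suc n) (suc k) ≈ stirling2 n k + ((1# + fromℕ k) - fromℕ n * lam) * stirling2 n (suc k)
  stirling2-rec n k = begin
    ((1# + N) * F) * ((w * I) * G₁′)
      ≈⟨ solve 5 (λ N F w I g → ((con (+ 1) :+ N) :* F) :* ((w :* I) :* g) := (F :* (w :* I)) :* ((con (+ 1) :+ N) :* g))
           refl N F w I G₁′ ⟩
    (F * (w * I)) * ((1# + N) * G₁′)
      ≈⟨ *-congˡ (expm1Pow-rec k n) ⟩
    (F * (w * I)) * ((1# + K) * (G₀ + G₁) - lam * (N * G₁))
      ≈⟨ solve 8 (λ F w I K G₀ G₁ L N →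
             (F :* (w :* I)) :* ((con (+ 1) :+ K) :* (G₀ :+ G₁) :- L :* (N :* G₁))
             := (w :* (con (+ 1) :+ K)) :* (F :* (I :* G₀)) :+ ((con (+ 1) :+ K) :- N :* L) :* (F :* ((w :* I) :* G₁)))
           refl F w I K G₀ G₁ lam N ⟩
    (w * (1# + K)) * (F * (I * G₀)) + ((1# + K) - N * lam) * (F * ((w * I) * G₁))
      ≈⟨ +-congʳ (trans (*-congʳ (inv-inverseˡ k)) (*-identityˡ _)) ⟩
    F * (I * G₀) + ((1# + K) - N * lam) * (F * ((w * I) * G₁)) ∎
    where
    N = fromℕ n
    K = fromℕ k
    F = fact n
    I = invFact k
    w = inv k
    G₀ = expm1Pow k n
    G₁ = expm1Pow (suc k) n
    G₁′ = expm1Pow (suc k) (suc n)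

  stirling2-combination : ∀ n k → fact k * (stirling2 (suc n) (suc k) + fromℕ n * lam * stirling2 n (suc k))
                                   ≈ fact n * (expm1Pow k n + expm1Pow (suc k) n)
  stirling2-combination n k = begin
    fk * (stirling2 (suc n) (suc k) + N * lam * stirling2 n (suc k))
      ≈⟨ *-congˡ (+-congʳ (stirling2-rec n k)) ⟩
    fk * ((F * (I * G₀) + ((1# + K) - N * lam) * (F * ((w * I) * G₁))) + N * lam * (F * ((w * I) * G₁)))
      ≈⟨ solve 9 (λ fk F I G₀ K N L w G₁ →
             fk :* ((F :* (I :* G₀) :+ ((con (+ 1) :+ K) :- N :* L) :* (F :* ((w :* I) :* G₁))) :+ N :* L :* (F :* ((w :* I) :* G₁)))
             := F :* ((fk :* I) :* G₀ :+ (fk :* I) :* (((con (+ 1) :+ K) :* w) :* G₁)))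
           refl fk F I G₀ K N lam w G₁ ⟩
    F * ((fk * I) * G₀ + (fk * I) * (((1# + K) * w) * G₁))
      ≈⟨ *-congˡ (+-cong (*-congʳ (fact-invFact k)) (*-cong (fact-invFact k) (*-congʳ (inv-r k)))) ⟩
    F * (1# * G₀ + 1# * (1# * G₁))
      ≈⟨ *-congˡ (+-cong (*-identityˡ _) (trans (*-identityˡ _) (*-identityˡ _))) ⟩
    F * (G₀ + G₁) ∎
    where
    N = fromℕ n
    K = fromℕ k
    F = fact n
    fk = fact k
    I = invFact k
    w = inv k
    G₀ = expm1Pow k n
    G₁ = expm1Pow (suc k) n

  fallλ-expansion : ∀ n x → fallλ lam x n ≈ sumTo n (λ k → stirling2 n k * fall x k)
  fallλ-expansion zero x = solve 0 (con (+ 1) := (con (+ 1) :* (con (+ 1) :* con (+ 1))) :* con (+ 1)) refl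
  fallλ-expansion (suc n) x = begin
    fallλ lam x n * (x - N * lam)
      ≈⟨ *-congʳ (fallλ-expansion n x) ⟩
    sumTo n (λ k → s n k * fall x k) * (x - N * lam)
      ≈⟨ trans (*-comm _ _) (*-distribˡ-sumTo n _ _) ⟩
    sumTo n (λ k → (x - N * lam) * (s n k * fall x k))
      ≈⟨ sumTo-cong n (λ k → solve 6 (λ x N L s f K → (x :- N :* L) :* (s :* f) := s :* (f :* (x :- K)) :+ ((K :- N :* L) :* s) :* f)
                                refl x N lam (s n k) (fall x k) (fromℕ k)) ⟩
    sumTo n (λ k → s n k * fall x (suc k) + φ k)
      ≈⟨ sumTo-+ n _ _ ⟩
    sumTo n (λ k → s n k * fall x (suc k)) + sumTo n φ
      ≈⟨ +-congˡ (sumTo-shift n φ φ₀≈0 φ₁₊ₙ≈0) ⟩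
    sumTo n (λ k → s n k * fall x (suc k)) + sumTo n (λ k → φ (suc k))
      ≈⟨ sumTo-+ n _ _ ⟨
    sumTo n (λ k → s n k * fall x (suc k) + φ (suc k))
      ≈⟨ sumTo-cong n (λ k → trans (solve 4 (λ a b c f → a :* f :+ (c :* b) :* f := (a :+ c :* b) :* f)
                                       refl (s n k) (s n (suc k)) ((1# + fromℕ k) - N * lam) (fall x (suc k)))
                                     (*-congʳ (sym (stirling2-rec n k)))) ⟩
    sumTo n (λ k → s (suc n) (suc k) * fall x (suc k))
      ≈⟨ +-identityˡ _ ⟨
    0# + sumTo n (λ k → s (suc n) (suc k) * fall x (suc k))
      ≈⟨ +-congʳ (trans (*-congʳ (trans (*-congˡ (zeroʳ _)) (zeroʳ _))) (zeroˡ _)) ⟨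
    s (suc n) 0 * fall x 0 + sumTo n (λ k → s (suc n) (suc k) * fall x (suc k))
      ≈⟨ sumTo-unfoldˡ n _ ⟨
    sumTo (suc n) (λ k → s (suc n) k * fall x k) ∎
    where
    s = stirling2
    N = fromℕ n
    φ : ℕ → Carrier
    φ k = ((fromℕ k - N * lam) * s n k) * fall x k
    -- stirling2 n 0 is n! [tⁿ] 1, which vanishes unless n = 0
    φ₀≈0 : φ 0 ≈ 0#
    φ₀≈0 = begin
      ((0# - N * lam) * (fact n * (1# * onePS n))) * 1#
        ≈⟨ solve 4 (λ N L F o → ((con (+ 0) :- N :* L) :* (F :* (con (+ 1) :* o))) :* con (+ 1) := :- (L :* F :* (N :* o)))
             refl N lam (fact n) (onePS n) ⟩
      - (lam * fact n * (N * onePS n))    ≈⟨ -‿cong (*-congˡ (n*onePSn≈0 n)) ⟩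
      - (lam * fact n * 0#)               ≈⟨ -‿cong (zeroʳ _) ⟩
      - 0#                                ≈⟨ -0#≈0# ⟩
      0#                                  ∎
      where
      n*onePSn≈0 : ∀ n → fromℕ n * onePS n ≈ 0#
      n*onePSn≈0 zero = zeroˡ _
      n*onePSn≈0 (suc n) = zeroʳ _
    φ₁₊ₙ≈0 : φ (suc n) ≈ 0#
    φ₁₊ₙ≈0 = trans (*-congʳ (trans (*-congˡ (stirling2-vanish n (suc n) ℕP.≤-refl)) (zeroʳ _))) (zeroˡ _)

  IsS2λ⇒≈stirling2 : ∀ S2 → IsS2λ lam S2 → ∀ n k → S2 n k ≈ stirling2 n k
  IsS2λ⇒≈stirling2 S2 (expansion , vanish) n k with k ℕ.≤? n
  ... | yes k≤n = fall-coefficients-unique n (S2 n) (stirling2 n)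
                    (λ x → trans (sym (expansion n x)) (fallλ-expansion n x)) k k≤n
  ... | no k≰n = trans (vanish n k (ℕP.≰⇒> k≰n)) (sym (stirling2-vanish n k (ℕP.≰⇒> k≰n)))

  L : PS
  L = logλ lam

  θlog : ∀ m → θ L (suc m) ≈ sgn m * binom (fromℕ m - lam) m
  θlog m = begin
    (1# + M) * ((sgn m * inv m) * binom (M - lam) m)
      ≈⟨ solve 4 (λ N s w b → N :* ((s :* w) :* b) := (N :* w) :* (s :* b)) refl (1# + M) (sgn m) (inv m) (binom (M - lam) m) ⟩
    ((1# + M) * inv m) * (sgn m * binom (M - lam) m)
      ≈⟨ trans (*-congʳ (inv-r m)) (*-identityˡ _) ⟩
    sgn m * binom (M - lam) m ∎
    where
    M = fromℕ m

  θlog-suc : ∀ m → θ L (suc (suc m)) ≈ (lam - fromℕ (suc m)) * L (suc m)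
  θlog-suc m = begin
    θ L (suc (suc m))
      ≈⟨ θlog (suc m) ⟩
    (- 1# * sgn m) * (fall ((1# + M) - lam) (suc m) * (inv m * invFact m))
      ≈⟨ *-congˡ (*-congʳ (trans (fall-unfoldˡ _ m)
           (*-congˡ (fall-cong (solve 2 (λ M L → ((con (+ 1) :+ M) :- L) :- con (+ 1) := M :- L) refl M lam) m)))) ⟩
    (- 1# * sgn m) * ((((1# + M) - lam) * fall (M - lam) m) * (inv m * invFact m))
      ≈⟨ solve 6 (λ s M L f w I → (:- con (+ 1) :* s) :* ((((con (+ 1) :+ M) :- L) :* f) :* (w :* I))
                                 := (L :- (con (+ 1) :+ M)) :* ((s :* w) :* (f :* I)))
           refl (sgn m) M lam (fall (M - lam) m) (inv m) (invFact m) ⟩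
    (lam - fromℕ (suc m)) * L (suc m) ∎
    where
    M = fromℕ m

  log-ode : (θ L ⊕ (t · θ L)) ≋ (t · (onePS ⊕ (cst lam · L)))
  log-ode zero = trans (+-cong (zeroˡ _) (t-·-zero (θ L))) (trans (+-identityˡ 0#) (sym (t-·-zero (onePS ⊕ (cst lam · L)))))
  log-ode (suc zero) = begin
    θ L 1 + (t · θ L) 1                    ≈⟨ +-cong (θlog 0) (t-·-suc (θ L) 0) ⟩
    1# * (1# * 1#) + 0# * 0#               ≈⟨ solve 1 (λ L → con (+ 1) :* (con (+ 1) :* con (+ 1)) :+ con (+ 0) :* con (+ 0)
                                                          := con (+ 1) :+ L :* con (+ 0)) refl lam ⟩
    1# + lam * 0#                          ≈⟨ +-congˡ (cst-· lam L 0) ⟨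
    1# + (cst lam · L) 0                   ≈⟨ t-·-suc (onePS ⊕ (cst lam · L)) 0 ⟨
    (t · (onePS ⊕ (cst lam · L))) 1        ∎
  log-ode (suc (suc m)) = begin
    θ L (suc (suc m)) + (t · θ L) (suc (suc m))
      ≈⟨ +-cong (θlog-suc m) (t-·-suc (θ L) (suc m)) ⟩
    (lam - fromℕ (suc m)) * L (suc m) + fromℕ (suc m) * L (suc m)
      ≈⟨ solve 3 (λ L N l → (L :- N) :* l :+ N :* l := con (+ 0) :+ L :* l) refl lam (fromℕ (suc m)) (L (suc m)) ⟩
    0# + lam * L (suc m)                             ≈⟨ +-congˡ (cst-· lam L (suc m)) ⟨
    0# + (cst lam · L) (suc m)                       ≈⟨ t-·-suc (onePS ⊕ (cst lam · L)) (suc m) ⟨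
    (t · (onePS ⊕ (cst lam · L))) (suc (suc m))      ∎

  logPow : ℕ → ℕ → Carrier
  logPow k n = powPS L k n

  logPow-vanish : ∀ k n → n < k → logPow k n ≈ 0#
  logPow-vanish = powPS-vanish L refl

  logPow-rec : ∀ k n → fromℕ (suc n) * logPow (suc k) (suc n)
                       ≈ fromℕ (suc k) * (logPow k n + lam * logPow (suc k) n) - fromℕ n * logPow (suc k) n
  logPow-rec k n = begin
    fromℕ (suc n) * logPow (suc k) (suc n)
      ≈⟨ ode-coefficients 1# (powPS L (suc k)) (cst K · (Q · Y)) (θ-powPS-ode (cst 1# · t) L Y k ode) n ⟩
    (cst K · (Q · Y)) n - 1# * (fromℕ n * logPow (suc k) n)
      ≈⟨ +-cong (trans (cst-· K (Q · Y) n) (*-congˡ (trans (QY n) (+-congˡ (cst-· lam (L · Q) n))))) (-‿cong (*-identityˡ _)) ⟩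
    K * (logPow k n + lam * logPow (suc k) n) - fromℕ n * logPow (suc k) n ∎
    where
    K = fromℕ (suc k)
    Q = powPS L k
    Y = onePS ⊕ (cst lam · L)
    ode : (θ L ⊕ ((cst 1# · t) · θ L)) ≋ (t · Y)
    ode = S.+-congˡ (·-congʳ (θ L) (λ n → trans (cst-· 1# t n) (*-identityˡ _))) ⨾ log-ode
    QY : (Q · Y) ≋ (Q ⊕ (cst lam · (L · Q)))
    QY = solveS 3 (λ Q c L → Q ⊠ (κ (+ 1) ⊞ (c ⊠ L)) ≐ Q ⊞ (c ⊠ (L ⊠ Q))) S.refl Q (cst lam) L

  -- The coefficient [tⁿ] (e_λ(log_λ(1+t)) - 1)ʲ, expanded without composing series.
  inversion : ℕ → ℕ → Carrier
  inversion n j = sumTo n (λ k → expm1Pow j k * logPow k n)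

  inversion-zero : ∀ n → inversion n 0 ≈ onePS n
  inversion-zero n = trans (sumTo-single n 0 _ z≤n others) (*-identityˡ _)
    where
    others : ∀ k → k ≤ n → k ≢ 0 → expm1Pow 0 k * logPow k n ≈ 0#
    others zero _ 0≢0 = contradiction ≡.refl 0≢0
    others (suc k) _ _ = zeroˡ _

  inversion-step : ∀ n j → fromℕ (suc n) * inversion (suc n) (suc j)
                           ≈ fromℕ (suc j) * (inversion n j + inversion n (suc j)) - fromℕ n * inversion n (suc j)
  inversion-step n j = begin
    N₁ * sumTo (suc n) (λ k → G′ k * Λ k (suc n))
      ≈⟨ trans (*-distribˡ-sumTo (suc n) N₁ _) (sumTo-unfoldˡ n _) ⟩
    N₁ * (G′ 0 * Λ 0 (suc n)) + sumTo n (λ k → N₁ * (G′ (suc k) * Λ (suc k) (suc n)))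
      ≈⟨ +-cong (trans (*-congˡ (zeroʳ _)) (zeroʳ _)) (sumTo-cong n term) ⟩
    0# + sumTo n (λ k → α k + Φ (suc k))
      ≈⟨ trans (+-identityˡ _) (sumTo-+ n _ _) ⟩
    sumTo n α + sumTo n (λ k → Φ (suc k))
      ≈⟨ +-congˡ (sumTo-shift n Φ Φ₀≈0 Φ₁₊ₙ≈0) ⟨
    sumTo n α + sumTo n Φ
      ≈⟨ sumTo-+ n _ _ ⟨
    sumTo n (λ k → α k + Φ k)
      ≈⟨ sumTo-cong n (λ k → solve 7 (λ J G G′ L K l N →
                                  (J :* (G :+ G′) :- L :* (K :* G′)) :* l :+ G′ :* ((K :* L :- N) :* l)
                                  := J :* (G :* l :+ G′ :* l) :+ (:- N) :* (G′ :* l))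
                                refl J₁ (G k) (G′ k) lam (fromℕ k) (Λ k n) N) ⟩
    sumTo n (λ k → J₁ * (G k * Λ k n + G′ k * Λ k n) + (- N) * (G′ k * Λ k n))
      ≈⟨ sumTo-linear n J₁ (- N) _ _ ⟩
    J₁ * sumTo n (λ k → G k * Λ k n + G′ k * Λ k n) + (- N) * inversion n (suc j)
      ≈⟨ +-cong (*-congˡ (sumTo-+ n _ _)) (sym (-‿distribˡ-* _ _)) ⟩
    J₁ * (inversion n j + inversion n (suc j)) - N * inversion n (suc j) ∎
    where
    N = fromℕ n
    N₁ = fromℕ (suc n)
    J₁ = fromℕ (suc j)
    G = expm1Pow j
    G′ = expm1Pow (suc j)
    Λ = logPow
    α : ℕ → Carrier
    α k = (J₁ * (G k + G′ k) - lam * (fromℕ k * G′ k)) * Λ k n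
    Φ : ℕ → Carrier
    Φ k = G′ k * ((fromℕ k * lam - N) * Λ k n)
    term : ∀ k → N₁ * (G′ (suc k) * Λ (suc k) (suc n)) ≈ α k + Φ (suc k)
    term k = begin
      N₁ * (G′ (suc k) * Λ (suc k) (suc n))
        ≈⟨ trans (solve 3 (λ N g l → N :* (g :* l) := g :* (N :* l)) refl N₁ (G′ (suc k)) (Λ (suc k) (suc n)))
                 (*-congˡ (logPow-rec k n)) ⟩
      G′ (suc k) * (K₁ * (Λ k n + lam * Λ (suc k) n) - N * Λ (suc k) n)
        ≈⟨ solve 6 (λ g K l L l₁ N → g :* (K :* (l :+ L :* l₁) :- N :* l₁) := (K :* g) :* l :+ g :* ((K :* L :- N) :* l₁))
             refl (G′ (suc k)) K₁ (Λ k n) lam (Λ (suc k) n) N ⟩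
      (K₁ * G′ (suc k)) * Λ k n + Φ (suc k)
        ≈⟨ +-congʳ (*-congʳ (expm1Pow-rec j k)) ⟩
      α k + Φ (suc k) ∎
      where
      K₁ = fromℕ (suc k)
    Φ₀≈0 : Φ 0 ≈ 0#
    Φ₀≈0 = trans (*-congʳ (expm1Pow-vanish (suc j) 0 (s≤s z≤n))) (zeroˡ _)
    Φ₁₊ₙ≈0 : Φ (suc n) ≈ 0#
    Φ₁₊ₙ≈0 = trans (*-congˡ (trans (*-congˡ (logPow-vanish (suc n) n ℕP.≤-refl)) (zeroʳ _))) (zeroʳ _)

  stirling-inversion : ∀ n j → (n ≡ j → inversion n j ≈ 1#) × (n ≢ j → inversion n j ≈ 0#)
  stirling-inversion zero zero = (λ _ → *-identityˡ 1#) , (λ 0≢0 → contradiction ≡.refl 0≢0)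
  stirling-inversion zero (suc j) = (λ ()) , (λ _ → trans (*-congʳ (expm1Pow-vanish (suc j) 0 (s≤s z≤n))) (zeroˡ _))
  stirling-inversion (suc n) zero = (λ ()) , (λ _ → inversion-zero (suc n))
  stirling-inversion (suc n) (suc j) = diagonal , off-diagonal
    where
    diagonal : suc n ≡ suc j → inversion (suc n) (suc j) ≈ 1#
    diagonal ≡.refl = fromℕ-suc-*-cancelˡ n (begin
      fromℕ (suc n) * inversion (suc n) (suc n)
        ≈⟨ inversion-step n n ⟩
      fromℕ (suc n) * (inversion n n + inversion n (suc n)) - fromℕ n * inversion n (suc n)
        ≈⟨ +-cong (*-congˡ (+-cong (proj₁ (stirling-inversion n n) ≡.refl) n,1+n≈0)) (-‿cong (*-congˡ n,1+n≈0)) ⟩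
      fromℕ (suc n) * (1# + 0#) - fromℕ n * 0#
        ≈⟨ solve 2 (λ N₁ N → N₁ :* (con (+ 1) :+ con (+ 0)) :- N :* con (+ 0) := N₁ :* con (+ 1)) refl _ _ ⟩
      fromℕ (suc n) * 1# ∎)
      where
      n,1+n≈0 : inversion n (suc n) ≈ 0#
      n,1+n≈0 = proj₂ (stirling-inversion n (suc n)) (ℕP.<⇒≢ (ℕP.n<1+n n))
    off-diagonal : suc n ≢ suc j → inversion (suc n) (suc j) ≈ 0#
    off-diagonal 1+n≢1+j = fromℕ-suc-*-cancelˡ n (trans (inversion-step n j) (step≈0 (n ℕ.≟ suc j)))
      where
      n,j≈0 : inversion n j ≈ 0#
      n,j≈0 = proj₂ (stirling-inversion n j) (λ n≡j → 1+n≢1+j (≡.cong suc n≡j))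
      n,1+j = stirling-inversion n (suc j)
      step≈0 : Dec (n ≡ suc j) →
               fromℕ (suc j) * (inversion n j + inversion n (suc j)) - fromℕ n * inversion n (suc j) ≈ fromℕ (suc n) * 0#
      step≈0 (yes n≡1+j) = begin
        fromℕ (suc j) * (inversion n j + inversion n (suc j)) - fromℕ n * inversion n (suc j)
          ≈⟨ +-cong (*-congˡ (+-cong n,j≈0 (proj₁ n,1+j n≡1+j)))
                    (-‿cong (*-cong (reflexive (≡.cong fromℕ n≡1+j)) (proj₁ n,1+j n≡1+j))) ⟩
        fromℕ (suc j) * (0# + 1#) - fromℕ (suc j) * 1#
          ≈⟨ solve 2 (λ J N₁ → J :* (con (+ 0) :+ con (+ 1)) :- J :* con (+ 1) := N₁ :* con (+ 0)) refl _ _ ⟩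
        fromℕ (suc n) * 0# ∎
      step≈0 (no n≢1+j) = begin
        fromℕ (suc j) * (inversion n j + inversion n (suc j)) - fromℕ n * inversion n (suc j)
          ≈⟨ +-cong (*-congˡ (+-cong n,j≈0 (proj₂ n,1+j n≢1+j))) (-‿cong (*-congˡ (proj₂ n,1+j n≢1+j))) ⟩
        fromℕ (suc j) * (0# + 0#) - fromℕ n * 0#
          ≈⟨ solve 3 (λ J N N₁ → J :* (con (+ 0) :+ con (+ 0)) :- N :* con (+ 0) := N₁ :* con (+ 0)) refl _ _ _ ⟩
        fromℕ (suc n) * 0# ∎

module EulerSeries {c ℓ} (A : QAlgebra c ℓ) (lam : QAlgebra.Carrier A)
             (E : ℕ → QAlgebra.Carrier A → QAlgebra.Carrier A) (isEuler : Ops.IsEulerλ A lam E) where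
  open QAlgebra A hiding (zero)
  open Ops A
  open Arithmetic A
  open FormalSeries A
  open DegenerateSeries A lam
  open IntegerCoefficientSolver cring using (solve; _:+_; _:*_; _:-_; :-_; con; _:=_)
  open import Algebra.Properties.Ring S.ring using () renaming (+-inverseˡ-unique to a⊕b≋0⇒a≋-b)
  open import Relation.Binary.Reasoning.Setoid setoid

  euler : PS
  euler n = E n 1# * invFact n

  fact-euler : ∀ n → fact n * euler n ≈ E n 1#
  fact-euler n = begin
    fact n * (E n 1# * invFact n)    ≈⟨ solve 3 (λ f x i → f :* (x :* i) := x :* (f :* i)) refl _ _ _ ⟩
    E n 1# * (fact n * invFact n)    ≈⟨ *-congˡ (fact-invFact n) ⟩
    E n 1# * 1#                      ≈⟨ *-identityʳ _ ⟩
    E n 1#                           ∎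

  e+1 : PS
  e+1 = e ⊕ onePS

  twoPS : PS
  twoPS = onePS ⊕ onePS

  halfPS : PS
  halfPS = cst half

  half-*-e+1-head : half * e+1 0 ≈ 1#
  half-*-e+1-head = trans (*-congˡ (+-congʳ e-head)) half-two

  halfPS-·-twoPS : (halfPS · twoPS) ≋ onePS
  halfPS-·-twoPS n = begin
    (halfPS · twoPS) n                 ≈⟨ cst-· half twoPS n ⟩
    half * (onePS n + onePS n)         ≈⟨ solve 2 (λ h o → h :* (o :+ o) := (h :* (con (+ 1) :+ con (+ 1))) :* o) refl half (onePS n) ⟩
    (half * two) * onePS n             ≈⟨ trans (*-congʳ half-two) (*-identityˡ _) ⟩
    onePS n                            ∎

  e+1-·-euler : (e+1 · euler) ≋ (twoPS · e)
  e+1-·-euler n = begin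
    (e+1 · euler) n                    ≈⟨ isEuler 1# n ⟩
    (1# + 1#) * e n                    ≈⟨ trans (distribʳ (e n) 1# 1#) (+-cong (*-identityˡ _) (*-identityˡ _)) ⟩
    e n + e n                          ≈⟨ +-cong (one-· e n) (one-· e n) ⟨
    (onePS · e) n + (onePS · e) n      ≈⟨ ·-distribʳ onePS onePS e n ⟨
    (twoPS · e) n                      ∎

  euler-head : euler 0 ≈ 1#
  euler-head = x-y≈0⇒x≈y _ _ (u*x≈0⇒x≈0 half-*-e+1-head (begin
    e+1 0 * (euler 0 - 1#)              ≈⟨ solve 2 (λ u x → u :* (x :- con (+ 1)) := u :* x :- u) refl (e+1 0) (euler 0) ⟩
    e+1 0 * euler 0 - e+1 0             ≈⟨ +-cong (e+1-·-euler 0) (-‿cong (+-congʳ e-head)) ⟩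
    (1# + 1#) * e 0 - (1# + 1#)         ≈⟨ +-congʳ (*-congˡ e-head) ⟩
    (1# + 1#) * 1# - (1# + 1#)          ≈⟨ solve 0 ((con (+ 1) :+ con (+ 1)) :* con (+ 1) :- (con (+ 1) :+ con (+ 1)) := con (+ 0)) refl ⟩
    0#                                  ∎))

  θ-e+1-·-euler : ((θ e · euler) ⊕ (e+1 · θ euler)) ≋ (twoPS · θ e)
  θ-e+1-·-euler =
    S.+-congʳ (·-congʳ euler (S.sym θe+1≋θe))
    ⨾ S.sym (θ-· e+1 euler)
    ⨾ θ-cong e+1-·-euler
    ⨾ θ-· twoPS e
    ⨾ S.+-congʳ (·-congʳ e (θ-⊕ onePS onePS ⨾ S.+-cong θ-one θ-one))
    ⨾ solveS 2 (λ x y → ((κ (+ 0) ⊞ κ (+ 0)) ⊠ x) ⊞ y ≐ y) S.refl e (twoPS · θ e)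
    where
    θe+1≋θe : θ e+1 ≋ θ e
    θe+1≋θe = θ-⊕ e onePS ⨾ S.+-congˡ θ-one ⨾ S.+-identityʳ (θ e)

  -- Differentiating (e + 1)·euler = 2e and using (1 + λt)·e′ = e, the defect of the Riccati
  -- equation times the unit e + 1 is a combination of known identities.
  euler-riccati : (θ euler ⊕ (λt · θ euler)) ≋ (t · (euler ⊕ negPS (halfPS · (euler · euler))))
  euler-riccati = a-b≋0⇒a≋b _ _ (unit-·-vanish e+1 _ half-*-e+1-head certificate)
    where
    certificate : (e+1 · ((θ euler ⊕ (λt · θ euler)) ⊕ negPS (t · (euler ⊕ negPS (halfPS · (euler · euler)))))) ≋ zeroPS
    certificate =
      solveS 7 (λ e u D θe λt t H →
          (e ⊞ κ (+ 1)) ⊠ ((D ⊞ (λt ⊠ D)) ⊟ (t ⊠ (u ⊟ (H ⊠ (u ⊠ u)))))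
          ≐ ((((κ (+ 1) ⊞ λt) ⊠ ((θe ⊠ u ⊞ (e ⊞ κ (+ 1)) ⊠ D) ⊟ (κ (+ 2) ⊠ θe)))
             ⊞ ((κ (+ 2) ⊟ u) ⊠ ((θe ⊞ λt ⊠ θe) ⊟ (t ⊠ e))))
             ⊞ ((⊟ t ⊠ (κ (+ 1) ⊟ H ⊠ u)) ⊠ (((e ⊞ κ (+ 1)) ⊠ u) ⊟ (κ (+ 2) ⊠ e))))
             ⊞ (((t ⊠ e) ⊠ u) ⊠ ((H ⊠ κ (+ 2)) ⊟ κ (+ 1))))
        S.refl e euler (θ euler) (θ e) λt t halfPS
      ⨾ ⊕-zero (⊕-zero (⊕-zero (·-annihilateʳ _ (a≋b⇒a-b≋0 θ-e+1-·-euler))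
                               (·-annihilateʳ _ (a≋b⇒a-b≋0 e-ode)))
                       (·-annihilateʳ _ (a≋b⇒a-b≋0 e+1-·-euler)))
               (·-annihilateʳ _ (a≋b⇒a-b≋0 halfPS-·-twoPS))

  eulerPow : ℕ → PS
  eulerPow m = powPS euler (suc m)

  eulerPow-rec : ∀ m n → fromℕ (suc n) * eulerPow m (suc n)
                         ≈ fromℕ (suc m) * (eulerPow m n - half * eulerPow (suc m) n) - lam * (fromℕ n * eulerPow m n)
  eulerPow-rec m n = begin
    fromℕ (suc n) * eulerPow m (suc n)
      ≈⟨ ode-coefficients lam (eulerPow m) (cst K · (Q · R)) (θ-powPS-ode λt euler R m euler-riccati) n ⟩
    (cst K · (Q · R)) n - lam * (fromℕ n * eulerPow m n)
      ≈⟨ +-congʳ (trans (cst-· K (Q · R) n) (*-congˡ (trans (QR n) (+-congˡ (-‿cong (cst-· half (eulerPow (suc m)) n)))))) ⟩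
    K * (eulerPow m n - half * eulerPow (suc m) n) - lam * (fromℕ n * eulerPow m n) ∎
    where
    K = fromℕ (suc m)
    Q = powPS euler m
    R = euler ⊕ negPS (halfPS · (euler · euler))
    QR : (Q · R) ≋ (eulerPow m ⊕ negPS (halfPS · eulerPow (suc m)))
    QR = solveS 3 (λ Q h u → Q ⊠ (u ⊟ (h ⊠ (u ⊠ u))) ≐ (u ⊠ Q) ⊟ (h ⊠ (u ⊠ (u ⊠ Q)))) S.refl Q halfPS euler

  bmat-closed-form : ∀ n m → bmat lam n m ≈ fact n * (pow half m * eulerPow m n)
  bmat-closed-form zero m =
    sym (trans (*-identityˡ _) (trans (*-congˡ (powPS-head euler euler-head (suc m))) (*-identityʳ _)))
  bmat-closed-form (suc n) m = begin
    M₁ * ((1# - N * lam * inv m) * bmat lam n m - bmat lam n (suc m))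
      ≈⟨ *-congˡ (+-cong (*-congˡ (bmat-closed-form n m)) (-‿cong (bmat-closed-form n (suc m)))) ⟩
    M₁ * ((1# - N * lam * inv m) * (F * (p * Pₙ)) - F * ((half * p) * Qₙ))
      ≈⟨ solve 9 (λ M₁ N L w F p Pₙ Qₙ h →
            M₁ :* ((con (+ 1) :- N :* L :* w) :* (F :* (p :* Pₙ)) :- F :* ((h :* p) :* Qₙ))
            := (F :* p) :* (M₁ :* Pₙ :- (M₁ :* w) :* (N :* L :* Pₙ) :- M₁ :* (h :* Qₙ)))
          refl M₁ N lam (inv m) F p Pₙ Qₙ half ⟩
    (F * p) * (M₁ * Pₙ - (M₁ * inv m) * (N * lam * Pₙ) - M₁ * (half * Qₙ))
      ≈⟨ *-congˡ (+-congʳ (+-congˡ (-‿cong (trans (*-congʳ (inv-r m)) (*-identityˡ _))))) ⟩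
    (F * p) * (M₁ * Pₙ - N * lam * Pₙ - M₁ * (half * Qₙ))
      ≈⟨ *-congˡ (solve 6 (λ M₁ N L Pₙ h Qₙ → M₁ :* Pₙ :- N :* L :* Pₙ :- M₁ :* (h :* Qₙ)
                                             := M₁ :* (Pₙ :- h :* Qₙ) :- L :* (N :* Pₙ)) refl M₁ N lam Pₙ half Qₙ) ⟩
    (F * p) * (M₁ * (Pₙ - half * Qₙ) - lam * (N * Pₙ))
      ≈⟨ *-congˡ (eulerPow-rec m n) ⟨
    (F * p) * ((1# + N) * eulerPow m (suc n))
      ≈⟨ solve 4 (λ F p N x → (F :* p) :* ((con (+ 1) :+ N) :* x) := ((con (+ 1) :+ N) :* F) :* (p :* x)) refl F p N (eulerPow m (suc n)) ⟩
    fact (suc n) * (pow half m * eulerPow m (suc n)) ∎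
    where
    M₁ = fromℕ (suc m)
    N = fromℕ n
    F = fact n
    p = pow half m
    Pₙ = eulerPow m n
    Qₙ = eulerPow (suc m) n

  bmat-column-zero : ∀ n → bmat lam n 0 ≈ E n 1#
  bmat-column-zero n = begin
    bmat lam n 0                   ≈⟨ bmat-closed-form n 0 ⟩
    fact n * (1# * eulerPow 0 n)   ≈⟨ *-congˡ (trans (*-identityˡ _) (S.*-identityʳ euler n)) ⟩
    fact n * euler n               ≈⟨ fact-euler n ⟩
    E n 1#                         ∎

  q : ℕ → Carrier
  q k = sgn k * pow half k

  -- The partial sums of 2/(e + 1) = 1/(1 + (e - 1)/2) = Σₖ (-1/2)ᵏ (e - 1)ᵏ.
  geometric : ℕ → PS
  geometric N m = sumTo N (λ k → q k * expm1Pow k m)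

  cst-q-suc : ∀ k → cst (q (suc k)) ≋ negPS (halfPS · cst (q k))
  cst-q-suc k n = begin
    ((- 1# * sgn k) * (half * pow half k)) * onePS n
      ≈⟨ solve 4 (λ s h p o → ((:- con (+ 1) :* s) :* (h :* p)) :* o := :- (h :* ((s :* p) :* o))) refl (sgn k) half (pow half k) (onePS n) ⟩
    - (half * (q k * onePS n))
      ≈⟨ -‿cong (cst-· half (cst (q k)) n) ⟨
    - (halfPS · cst (q k)) n ∎

  cst-q-zero : cst (q 0) ≋ onePS
  cst-q-zero n = solve 1 (λ o → (con (+ 1) :* con (+ 1)) :* o := o) refl (onePS n)

  geometric-telescope : ∀ N → ((onePS ⊕ (halfPS · expm1)) · geometric N)
                              ≋ (onePS ⊕ negPS (cst (q (suc N)) · powPS expm1 (suc N)))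
  geometric-telescope zero =
    ·-congˡ (onePS ⊕ (halfPS · expm1)) cst-q-zero
    ⨾ solveS 2 (λ H g → (κ (+ 1) ⊞ (H ⊠ g)) ⊠ κ (+ 1) ≐ κ (+ 1) ⊟ ((⊟ (H ⊠ κ (+ 1))) ⊠ (g ⊠ κ (+ 1)))) S.refl halfPS expm1
    ⨾ S.+-congˡ (S.-‿cong (·-congʳ (expm1 · onePS) (S.sym (cst-q-suc 0 ⨾ S.-‿cong (·-congˡ halfPS cst-q-zero)))))
  geometric-telescope (suc N) =
    ·-congˡ U geometric-suc
    ⨾ S.distribˡ U (geometric N) (C · Q)
    ⨾ S.+-congʳ (geometric-telescope N)
    ⨾ solveS 4 (λ H g C Q → (κ (+ 1) ⊟ (C ⊠ Q)) ⊞ ((κ (+ 1) ⊞ (H ⊠ g)) ⊠ (C ⊠ Q)) ≐ κ (+ 1) ⊟ ((⊟ (H ⊠ C)) ⊠ (g ⊠ Q)))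
        S.refl halfPS expm1 C Q
    ⨾ S.+-congˡ (S.-‿cong (·-congʳ (expm1 · Q) (S.sym (cst-q-suc (suc N)))))
    where
    U = onePS ⊕ (halfPS · expm1)
    C = cst (q (suc N))
    Q = powPS expm1 (suc N)
    geometric-suc : geometric (suc N) ≋ (geometric N ⊕ (C · Q))
    geometric-suc m = +-congˡ (sym (cst-· (q (suc N)) Q m))

  geometric-error : ∀ N → (e+1 · ((geometric N · e) ⊕ negPS euler))
                          ≋ negPS (twoPS · (cst (q (suc N)) · (powPS expm1 (suc N) · e)))
  geometric-error N = a⊕b≋0⇒a≋-b (e+1 · ((geometric N · e) ⊕ negPS euler)) (twoPS · (cst (q (suc N)) · (powPS expm1 (suc N) · e))) (
    solveS 6 (λ e H S u C Q →
        ((e ⊞ κ (+ 1)) ⊠ ((S ⊠ e) ⊟ u)) ⊞ (κ (+ 2) ⊠ (C ⊠ (Q ⊠ e)))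
        ≐ (((κ (+ 2) ⊠ e) ⊠ (((κ (+ 1) ⊞ (H ⊠ (e ⊟ κ (+ 1)))) ⊠ S) ⊟ (κ (+ 1) ⊟ (C ⊠ Q))))
          ⊞ ((⊟ ((e ⊟ κ (+ 1)) ⊠ (S ⊠ e))) ⊠ ((H ⊠ κ (+ 2)) ⊟ κ (+ 1))))
          ⊞ (⊟ κ (+ 1) ⊠ (((e ⊞ κ (+ 1)) ⊠ u) ⊟ (κ (+ 2) ⊠ e))))
      S.refl e halfPS (geometric N) euler (cst (q (suc N))) (powPS expm1 (suc N))
    ⨾ ⊕-zero (⊕-zero (·-annihilateʳ _ (a≋b⇒a-b≋0 (geometric-telescope N)))
                     (·-annihilateʳ _ (a≋b⇒a-b≋0 halfPS-·-twoPS)))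
             (·-annihilateʳ _ (a≋b⇒a-b≋0 e+1-·-euler)))

  geometric-·-e≈euler : ∀ N j → j ≤ N → (geometric N · e) j ≈ euler j
  geometric-·-e≈euler N j j≤N =
    x-y≈0⇒x≈y _ _ (unit-·-vanish≤ e+1 ((geometric N · e) ⊕ negPS euler) N half-*-e+1-head (λ i i≤N → trans (geometric-error N i) (error≈0 i i≤N)) j j≤N)
    where
    error≈0 : ∀ i → i ≤ N → negPS (twoPS · (cst (q (suc N)) · (powPS expm1 (suc N) · e))) i ≈ 0#
    error≈0 i i≤N = trans (-‿cong (·-vanishʳ i twoPS _ λ i₁ i₁≤i → ·-vanishʳ i₁ (cst (q (suc N))) _ λ i₂ i₂≤i₁ →
                      ·-vanishˡ i₂ (powPS expm1 (suc N)) e λ l l≤i₂ →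
                        expm1Pow-vanish (suc N) l (s≤s (ℕP.≤-trans l≤i₂ (ℕP.≤-trans i₂≤i₁ (ℕP.≤-trans i₁≤i i≤N))))))
                    -0#≈0#

  geometric-·-e : ∀ N m → (geometric N · e) m ≈ sumTo N (λ k → q k * (expm1Pow k m + expm1Pow (suc k) m))
  geometric-·-e N m = trans (·-distribʳ-sumTo N (λ k → q k ⊛ powPS expm1 k) e m)
    (sumTo-cong N (λ k → trans (⊛-· (q k) (powPS expm1 k) e m) (*-congˡ (powPS-expm1-·-e k m))))

  euler-expansion : ∀ N k → k ≤ N → E k 1# ≈ fact k * sumTo N (λ j → q j * (expm1Pow j k + expm1Pow (suc j) k))
  euler-expansion N k k≤N = begin
    E k 1#                       ≈⟨ fact-euler k ⟨
    fact k * euler k             ≈⟨ *-congˡ (geometric-·-e≈euler N k k≤N) ⟨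
    fact k * (geometric N · e) k ≈⟨ *-congˡ (geometric-·-e N k) ⟩
    fact k * sumTo N (λ j → q j * (expm1Pow j k + expm1Pow (suc j) k)) ∎

  stirling2-sum≈euler : ∀ S2 → IsS2λ lam S2 → ∀ n →
    sumTo n (λ k → sgn k * fact k * (S2 (suc n) (suc k) + fromℕ n * lam * S2 n (suc k)) * pow half k) ≈ E n 1#
  stirling2-sum≈euler S2 isS2 n = begin
    sumTo n (λ k → sgn k * fact k * (S2 (suc n) (suc k) + N * lam * S2 n (suc k)) * pow half k)
      ≈⟨ sumTo-cong n term ⟩
    sumTo n (λ k → fact n * (q k * (expm1Pow k n + expm1Pow (suc k) n)))
      ≈⟨ *-distribˡ-sumTo n _ _ ⟨
    fact n * sumTo n (λ k → q k * (expm1Pow k n + expm1Pow (suc k) n))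
      ≈⟨ euler-expansion n n ℕP.≤-refl ⟨
    E n 1# ∎
    where
    N = fromℕ n
    S2≈ = IsS2λ⇒≈stirling2 S2 isS2
    term : ∀ k → sgn k * fact k * (S2 (suc n) (suc k) + N * lam * S2 n (suc k)) * pow half k
                 ≈ fact n * (q k * (expm1Pow k n + expm1Pow (suc k) n))
    term k = begin
      sgn k * fact k * (S2 (suc n) (suc k) + N * lam * S2 n (suc k)) * pow half k
        ≈⟨ *-congʳ (*-congˡ (+-cong (S2≈ (suc n) (suc k)) (*-congˡ (S2≈ n (suc k))))) ⟩
      sgn k * fact k * X * pow half k
        ≈⟨ solve 4 (λ s f X p → s :* f :* X :* p := (s :* p) :* (f :* X)) refl (sgn k) (fact k) X (pow half k) ⟩
      q k * (fact k * X)
        ≈⟨ *-congˡ (stirling2-combination n k) ⟩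
      q k * (fact n * (expm1Pow k n + expm1Pow (suc k) n))
        ≈⟨ solve 3 (λ q F G → q :* (F :* G) := F :* (q :* G)) refl (q k) (fact n) _ ⟩
      fact n * (q k * (expm1Pow k n + expm1Pow (suc k) n)) ∎
      where
      X = stirling2 (suc n) (suc k) + N * lam * stirling2 n (suc k)

  stirling1-sum : ∀ n → 1 ≤ n → sumTo n (λ k → S1λ lam n k * E k 1#) ≈ sgn (n ∸ 1) * fact n * pow half n
  stirling1-sum (suc m) _ = begin
    sumTo n (λ k → S1λ lam n k * E k 1#)
      ≈⟨ sumTo-cong≤ n term ⟩
    sumTo n (λ k → F * (logPow k n * sumTo n (λ j → q j * H j k)))
      ≈⟨ *-distribˡ-sumTo n F _ ⟨
    F * sumTo n (λ k → logPow k n * sumTo n (λ j → q j * H j k))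
      ≈⟨ *-congˡ (sumTo-cong n (λ k → *-distribˡ-sumTo n _ _)) ⟩
    F * sumTo n (λ k → sumTo n (λ j → logPow k n * (q j * H j k)))
      ≈⟨ *-congˡ (sumTo-swap n n _) ⟩
    F * sumTo n (λ j → sumTo n (λ k → logPow k n * (q j * H j k)))
      ≈⟨ *-congˡ (sumTo-cong n inner) ⟩
    F * sumTo n (λ j → q j * inversion n j + q j * inversion n (suc j))
      ≈⟨ *-congˡ (trans (sumTo-+ n _ _) (+-cong diagonal subdiagonal)) ⟩
    F * (q n + q m)
      ≈⟨ solve 4 (λ F s h p → F :* ((:- con (+ 1) :* s) :* (h :* p) :+ s :* p)
                              := s :* F :* (h :* p) :+ (F :* s :* p) :* (con (+ 1) :- h :* (con (+ 1) :+ con (+ 1))))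
           refl F (sgn m) half (pow half m) ⟩
    sgn m * F * pow half n + (F * sgn m * pow half m) * (1# - half * two)
      ≈⟨ +-congˡ (trans (*-congˡ (x≈y⇒x-y≈0 (sym half-two))) (zeroʳ _)) ⟩
    sgn m * F * pow half n + 0#
      ≈⟨ +-identityʳ _ ⟩
    sgn m * F * pow half n ∎
    where
    n = suc m
    F = fact n
    H : ℕ → ℕ → Carrier
    H j k = expm1Pow j k + expm1Pow (suc j) k
    term : ∀ k → k ≤ n → S1λ lam n k * E k 1# ≈ F * (logPow k n * sumTo n (λ j → q j * H j k))
    term k k≤n = begin
      (F * (invFact k * logPow k n)) * E k 1#
        ≈⟨ *-congˡ (euler-expansion n k k≤n) ⟩
      (F * (invFact k * logPow k n)) * (fact k * Σ)
        ≈⟨ solve 5 (λ F I l f Σ → (F :* (I :* l)) :* (f :* Σ) := F :* ((f :* I) :* (l :* Σ))) refl F (invFact k) (logPow k n) (fact k) Σ ⟩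
      F * ((fact k * invFact k) * (logPow k n * Σ))
        ≈⟨ *-congˡ (trans (*-congʳ (fact-invFact k)) (*-identityˡ _)) ⟩
      F * (logPow k n * Σ) ∎
      where
      Σ = sumTo n (λ j → q j * H j k)
    inner : ∀ j → sumTo n (λ k → logPow k n * (q j * H j k)) ≈ q j * inversion n j + q j * inversion n (suc j)
    inner j = trans
      (sumTo-cong n (λ k → solve 4 (λ l q g g′ → l :* (q :* (g :+ g′)) := q :* (g :* l) :+ q :* (g′ :* l))
                                  refl (logPow k n) (q j) (expm1Pow j k) (expm1Pow (suc j) k)))
      (sumTo-linear n (q j) (q j) _ _)
    diagonal : sumTo n (λ j → q j * inversion n j) ≈ q n
    diagonal = begin
      sumTo n (λ j → q j * inversion n j)
        ≈⟨ sumTo-single n n _ ℕP.≤-refl (λ j _ j≢n → trans (*-congˡ (proj₂ (stirling-inversion n j) (λ n≡j → j≢n (≡.sym n≡j)))) (zeroʳ _)) ⟩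
      q n * inversion n n
        ≈⟨ trans (*-congˡ (proj₁ (stirling-inversion n n) ≡.refl)) (*-identityʳ _) ⟩
      q n ∎
    subdiagonal : sumTo n (λ j → q j * inversion n (suc j)) ≈ q m
    subdiagonal = begin
      sumTo n (λ j → q j * inversion n (suc j))
        ≈⟨ sumTo-single n m _ (ℕP.n≤1+n m) (λ j _ j≢m →
             trans (*-congˡ (proj₂ (stirling-inversion n (suc j)) (λ n≡1+j → j≢m (ℕP.suc-injective (≡.sym n≡1+j))))) (zeroʳ _)) ⟩
      q m * inversion n n
        ≈⟨ trans (*-congˡ (proj₁ (stirling-inversion n n) ≡.refl)) (*-identityʳ _) ⟩
      q m ∎

theorem3p4 : ∀ {c ℓ} (A : QAlgebra c ℓ) →
    let open QAlgebra A
        open Ops A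
    in (lam : Carrier) → ¬ (lam ≈ 0#) →
       (S2 : ℕ → ℕ → Carrier) → IsS2λ lam S2 →
       (E : ℕ → Carrier → Carrier) → IsEulerλ lam E →
       (∀ n →
          (bmat lam n 0
             ≈ sumTo n (λ k → sgn k * fact k
                 * (S2 (suc n) (suc k) + fromℕ n * lam * S2 n (suc k))
                 * pow half k))
          × (sumTo n (λ k → sgn k * fact k
                 * (S2 (suc n) (suc k) + fromℕ n * lam * S2 n (suc k))
                 * pow half k)
             ≈ E n 1#))
       × (∀ n → 1 ≤ n →
          sumTo n (λ k → S1λ lam n k * E k 1#)
            ≈ sgn (n ∸ 1) * fact n * pow half n)
theorem3p4 A lam _ S2 isS2 E isEuler =
  (λ n → trans (bmat-column-zero n) (sym (stirling2-sum≈euler S2 isS2 n)) , stirling2-sum≈euler S2 isS2 n)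
  , stirling1-sum
  where
  open QAlgebra A using (sym; trans)
  open EulerSeries A lam E isEuler
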